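{- Let $\mathcal{X}$ be a Scott set, $T\in\mathcal{X}$ a complete consistent extension of $\mathrm{PA}$, and $M\models T$ a model coded in $\mathcal{X}$. Let $U$ be a non-principal ultrafilter on $\mathcal{X}$. Then the structure $K=\prod_{\mathcal{X}}M/U$ is recursively saturated.
   Context: Formulas are identified with Gödel numbers. A Scott set is a non-empty $\mathcal{X}\subseteq\mathcal{P}(\omega)$ closed under finite unions, complements and relative recursiveness, such that every theory in $\mathcal{X}$ (in a recursive language) has a complete consistent extension in $\mathcal{X}$. A model $M$ is coded in $\mathcal{X}$ if (up to isomorphism) its domain is a subset of $\omega$ belonging to $\mathcal{X}$ and its elementary diagram $\mathrm{Th}(M,a)_{a\in M}$ belongs to $\mathcal{X}$. $\prod_{\mathcal{X}}M$ is the set of functions $f:\omega\to M$ whose graphs (coded via a pairing function) belong to $\mathcal{X}$. A non-principal ultrafilter on $\mathcal{X}$ is an ultrafilter on the Boolean algebra $\mathcal{X}$ containing no finite set. $\prod_{\mathcal{X}}M/U$ is the quotient of $\prod_{\mathcal{X}}M$ by $f\equiv_U g\iff\{n: f(n)=g(n)\}\in U$, with $0,1,+,\cdot,<$ interpreted pointwise (relations holding when they hold on a set in $U$). A model is recursively saturated if every type $p(\bar x,\bar a)$ with finitely many parameters $\bar a$ from the model, consistent with the theory of the model with $\bar a$, and such that $\{\ulcorner\varphi(\bar x,\bar y)\urcorner:\varphi(\bar x,\bar a)\in p\}$ is recursive, is realized. -}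

module Defs where

open import Data.Nat using (ℕ; zero; suc; _+_; _*_; _≤_; _<_; _≡ᵇ_)
open import Data.Bool using (Bool; true; false; not; _∨_; _∧_; if_then_else_)
open import Data.Fin using (Fin) renaming (zero to fzero; suc to fsuc)
open import Data.Vec using (Vec; []; _∷_; lookup)
open import Data.List using (List; map) renaming (_∷_ to _∷ˡ_)
open import Data.List.Membership.Propositional using (_∈_)
open import Data.Product using (Σ; _×_; _,_)
open import Data.Sum using (_⊎_)
open import Data.Empty using (⊥)
open import Relation.Nullary using (¬_)
open import Relation.Binary.PropositionalEquality using (_≡_)

Subset : Set
Subset = ℕ → Bool

_⊆ˢ_ : Subset → Subset → Set
A ⊆ˢ B = ∀ n → A n ≡ true → B n ≡ true

Finite : Subset → Set
Finite A = Σ ℕ λ k → ∀ n → A n ≡ true → n < k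

tri : ℕ → ℕ
tri zero = zero
tri (suc k) = suc k + tri k

pair : ℕ → ℕ → ℕ
pair a b = tri (a + b) + a

anyUpTo : ℕ → (ℕ → Bool) → Bool
anyUpTo zero p = p zero
anyUpTo (suc k) p = anyUpTo k p ∨ p (suc k)

-- the graph {⟨n , f n⟩ : n ∈ ω} of f (note ⟨n,m⟩ ≥ n)
graph : (ℕ → ℕ) → Subset
graph f k = anyUpTo k (λ n → pair n (f n) ≡ᵇ k)

data Prog : ℕ → Set where
  pzero  : ∀ {k} → Prog k
  psuc   : Prog 1
  proj   : ∀ {k} → Fin k → Prog k
  comp   : ∀ {k m} → Prog m → Vec (Prog k) m → Prog k
  prec   : ∀ {k} → Prog k → Prog (suc (suc k)) → Prog (suc k)
  pmu    : ∀ {k} → Prog (suc k) → Prog k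
  oracle : Prog 1

mutual
  data Eval (B : Subset) : {k : ℕ} → Prog k → Vec ℕ k → ℕ → Set where
    e-zero : ∀ {k} {xs : Vec ℕ k} → Eval B pzero xs 0
    e-suc  : ∀ {x} → Eval B psuc (x ∷ []) (suc x)
    e-proj : ∀ {k} {xs : Vec ℕ k} {i} → Eval B (proj i) xs (lookup xs i)
    e-comp : ∀ {k m} {f : Prog m} {gs : Vec (Prog k) m} {xs ys y} →
             EvalVec B gs xs ys → Eval B f ys y → Eval B (comp f gs) xs y
    e-prec0 : ∀ {k} {g : Prog k} {h} {xs y} →
              Eval B g xs y → Eval B (prec g h) (0 ∷ xs) y
    e-precS : ∀ {k} {g : Prog k} {h} {xs n y z} →
              Eval B (prec g h) (n ∷ xs) y → Eval B h (n ∷ y ∷ xs) z →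
              Eval B (prec g h) (suc n ∷ xs) z
    e-mu   : ∀ {k} {f : Prog (suc k)} {xs n} →
             Eval B f (n ∷ xs) 0 →
             (∀ i → i < n → Σ ℕ λ v → Eval B f (i ∷ xs) (suc v)) →
             Eval B (pmu f) xs n
    e-orc  : ∀ {x} → Eval B oracle (x ∷ []) (if B x then 1 else 0)

  data EvalVec (B : Subset) {k : ℕ} : {m : ℕ} → Vec (Prog k) m → Vec ℕ k → Vec ℕ m → Set where
    ev-[] : ∀ {xs} → EvalVec B [] xs []
    ev-∷  : ∀ {m} {g} {gs : Vec (Prog k) m} {xs y ys} →
            Eval B g xs y → EvalVec B gs xs ys → EvalVec B (g ∷ gs) xs (y ∷ ys)

_≤T_ : Subset → Subset → Set
A ≤T B = Σ (Prog 1) λ p → ∀ n → Eval B p (n ∷ []) (if A n then 1 else 0)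

Recursive : Subset → Set
Recursive A = A ≤T (λ _ → false)

-- First-order language of arithmetic {0,1,+,·,<,=} with constants c_j (j ∈ ω),
-- variables as de Bruijn indices

infixl 7 _`*_
infixl 6 _`+_
infix 4 _`=_ _`<_
infixr 3 _`∧_
infixr 2 _`∨_
infixr 1 _`→_ _`↔_

data Term : Set where
  var  : ℕ → Term
  con  : ℕ → Term
  `0   : Term
  `1   : Term
  _`+_ : Term → Term → Term
  _`*_ : Term → Term → Term

data Formula : Set where
  _`=_ : Term → Term → Formula
  _`<_ : Term → Term → Formula
  `⊥   : Formula
  _`∧_ : Formula → Formula → Formula
  _`∨_ : Formula → Formula → Formula
  _`→_ : Formula → Formula → Formula
  `∀   : Formula → Formula
  `∃   : Formula → Formula

`¬ : Formula → Formula
`¬ φ = φ `→ `⊥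

_`↔_ : Formula → Formula → Formula
φ `↔ ψ = (φ `→ ψ) `∧ (ψ `→ φ)

`∀^ : ℕ → Formula → Formula
`∀^ zero φ = φ
`∀^ (suc k) φ = `∀ (`∀^ k φ)

⌜_⌝ᵗ : Term → ℕ
⌜ var n ⌝ᵗ = pair 0 n
⌜ con n ⌝ᵗ = pair 1 n
⌜ `0 ⌝ᵗ = pair 2 0
⌜ `1 ⌝ᵗ = pair 3 0
⌜ s `+ t ⌝ᵗ = pair 4 (pair ⌜ s ⌝ᵗ ⌜ t ⌝ᵗ)
⌜ s `* t ⌝ᵗ = pair 5 (pair ⌜ s ⌝ᵗ ⌜ t ⌝ᵗ)

⌜_⌝ : Formula → ℕ
⌜ s `= t ⌝ = pair 0 (pair ⌜ s ⌝ᵗ ⌜ t ⌝ᵗ)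
⌜ s `< t ⌝ = pair 1 (pair ⌜ s ⌝ᵗ ⌜ t ⌝ᵗ)
⌜ `⊥ ⌝ = pair 2 0
⌜ φ `∧ ψ ⌝ = pair 3 (pair ⌜ φ ⌝ ⌜ ψ ⌝)
⌜ φ `∨ ψ ⌝ = pair 4 (pair ⌜ φ ⌝ ⌜ ψ ⌝)
⌜ φ `→ ψ ⌝ = pair 5 (pair ⌜ φ ⌝ ⌜ ψ ⌝)
⌜ `∀ φ ⌝ = pair 6 ⌜ φ ⌝
⌜ `∃ φ ⌝ = pair 7 ⌜ φ ⌝

FVBelowᵗ : ℕ → Term → Set
FVBelowᵗ k (var n) = n < k
FVBelowᵗ k (con _) = Data.Unit.⊤ where import Data.Unit
FVBelowᵗ k `0 = Data.Unit.⊤ where import Data.Unit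
FVBelowᵗ k `1 = Data.Unit.⊤ where import Data.Unit
FVBelowᵗ k (s `+ t) = FVBelowᵗ k s × FVBelowᵗ k t
FVBelowᵗ k (s `* t) = FVBelowᵗ k s × FVBelowᵗ k t

FVBelow : ℕ → Formula → Set
FVBelow k (s `= t) = FVBelowᵗ k s × FVBelowᵗ k t
FVBelow k (s `< t) = FVBelowᵗ k s × FVBelowᵗ k t
FVBelow k `⊥ = Data.Unit.⊤ where import Data.Unit
FVBelow k (φ `∧ ψ) = FVBelow k φ × FVBelow k ψ
FVBelow k (φ `∨ ψ) = FVBelow k φ × FVBelow k ψ
FVBelow k (φ `→ ψ) = FVBelow k φ × FVBelow k ψ
FVBelow k (`∀ φ) = FVBelow (suc k) φ
FVBelow k (`∃ φ) = FVBelow (suc k) φ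

Sentence : Formula → Set
Sentence = FVBelow 0

AllConstsᵗ : (ℕ → Set) → Term → Set
AllConstsᵗ Q (var _) = Data.Unit.⊤ where import Data.Unit
AllConstsᵗ Q (con j) = Q j
AllConstsᵗ Q `0 = Data.Unit.⊤ where import Data.Unit
AllConstsᵗ Q `1 = Data.Unit.⊤ where import Data.Unit
AllConstsᵗ Q (s `+ t) = AllConstsᵗ Q s × AllConstsᵗ Q t
AllConstsᵗ Q (s `* t) = AllConstsᵗ Q s × AllConstsᵗ Q t

AllConsts : (ℕ → Set) → Formula → Set
AllConsts Q (s `= t) = AllConstsᵗ Q s × AllConstsᵗ Q t
AllConsts Q (s `< t) = AllConstsᵗ Q s × AllConstsᵗ Q t
AllConsts Q `⊥ = Data.Unit.⊤ where import Data.Unit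
AllConsts Q (φ `∧ ψ) = AllConsts Q φ × AllConsts Q ψ
AllConsts Q (φ `∨ ψ) = AllConsts Q φ × AllConsts Q ψ
AllConsts Q (φ `→ ψ) = AllConsts Q φ × AllConsts Q ψ
AllConsts Q (`∀ φ) = AllConsts Q φ
AllConsts Q (`∃ φ) = AllConsts Q φ

ConstFree : Formula → Set
ConstFree = AllConsts (λ _ → ⊥)

substT : (ℕ → Term) → Term → Term
substT σ (var n) = σ n
substT σ (con j) = con j
substT σ `0 = `0
substT σ `1 = `1
substT σ (s `+ t) = substT σ s `+ substT σ t
substT σ (s `* t) = substT σ s `* substT σ t

liftS : (ℕ → Term) → ℕ → Term
liftS σ zero = var zero
liftS σ (suc n) = substT (λ i → var (suc i)) (σ n)

substF : (ℕ → Term) → Formula → Formula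
substF σ (s `= t) = substT σ s `= substT σ t
substF σ (s `< t) = substT σ s `< substT σ t
substF σ `⊥ = `⊥
substF σ (φ `∧ ψ) = substF σ φ `∧ substF σ ψ
substF σ (φ `∨ ψ) = substF σ φ `∨ substF σ ψ
substF σ (φ `→ ψ) = substF σ φ `→ substF σ ψ
substF σ (`∀ φ) = `∀ (substF (liftS σ) φ)
substF σ (`∃ φ) = `∃ (substF (liftS σ) φ)

shiftF : Formula → Formula
shiftF = substF (λ i → var (suc i))

_∷ₛ_ : Term → (ℕ → Term) → ℕ → Term
(t ∷ₛ σ) zero = t
(t ∷ₛ σ) (suc n) = σ n

_[_] : Formula → Term → Formula
φ [ t ] = substF (t ∷ₛ var) φ

data Deriv (Ax : Formula → Set) : List Formula → Formula → Set where
  ax    : ∀ {Γ φ} → Ax φ → Sentence φ → Deriv Ax Γ φ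
  hyp   : ∀ {Γ φ} → φ ∈ Γ → Deriv Ax Γ φ
  ⊥E    : ∀ {Γ φ} → Deriv Ax Γ `⊥ → Deriv Ax Γ φ
  raa   : ∀ {Γ φ} → Deriv Ax (`¬ φ ∷ˡ Γ) `⊥ → Deriv Ax Γ φ
  →I    : ∀ {Γ φ ψ} → Deriv Ax (φ ∷ˡ Γ) ψ → Deriv Ax Γ (φ `→ ψ)
  →E    : ∀ {Γ φ ψ} → Deriv Ax Γ (φ `→ ψ) → Deriv Ax Γ φ → Deriv Ax Γ ψ
  ∧I    : ∀ {Γ φ ψ} → Deriv Ax Γ φ → Deriv Ax Γ ψ → Deriv Ax Γ (φ `∧ ψ)
  ∧E₁   : ∀ {Γ φ ψ} → Deriv Ax Γ (φ `∧ ψ) → Deriv Ax Γ φ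
  ∧E₂   : ∀ {Γ φ ψ} → Deriv Ax Γ (φ `∧ ψ) → Deriv Ax Γ ψ
  ∨I₁   : ∀ {Γ φ ψ} → Deriv Ax Γ φ → Deriv Ax Γ (φ `∨ ψ)
  ∨I₂   : ∀ {Γ φ ψ} → Deriv Ax Γ ψ → Deriv Ax Γ (φ `∨ ψ)
  ∨E    : ∀ {Γ φ ψ χ} → Deriv Ax Γ (φ `∨ ψ) → Deriv Ax (φ ∷ˡ Γ) χ →
          Deriv Ax (ψ ∷ˡ Γ) χ → Deriv Ax Γ χ
  ∀I    : ∀ {Γ φ} → Deriv Ax (map shiftF Γ) φ → Deriv Ax Γ (`∀ φ)
  ∀E    : ∀ {Γ φ} → Deriv Ax Γ (`∀ φ) → (t : Term) → Deriv Ax Γ (φ [ t ])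
  ∃I    : ∀ {Γ φ} (t : Term) → Deriv Ax Γ (φ [ t ]) → Deriv Ax Γ (`∃ φ)
  ∃E    : ∀ {Γ φ ψ} → Deriv Ax Γ (`∃ φ) →
          Deriv Ax (φ ∷ˡ map shiftF Γ) (shiftF ψ) → Deriv Ax Γ ψ
  =refl : ∀ {Γ} (t : Term) → Deriv Ax Γ (t `= t)
  =subst : ∀ {Γ s t φ} → Deriv Ax Γ (s `= t) → Deriv Ax Γ (φ [ s ]) →
           Deriv Ax Γ (φ [ t ])

Consistent : (Formula → Set) → Set
Consistent Ax = ¬ Deriv Ax Data.List.[] `⊥

AxOf : Subset → Formula → Set
AxOf S φ = S ⌜ φ ⌝ ≡ true

IsTheory : Subset → Set
IsTheory S = ∀ k → S k ≡ true → Σ Formula λ φ → (⌜ φ ⌝ ≡ k) × Sentence φ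

IsLATheory : Subset → Set
IsLATheory S = ∀ k → S k ≡ true → Σ Formula λ φ → (⌜ φ ⌝ ≡ k) × Sentence φ × ConstFree φ

Complete : Subset → Set
Complete S = ∀ φ → Sentence φ → (S ⌜ φ ⌝ ≡ true) ⊎ (S ⌜ `¬ φ ⌝ ≡ true)

CompleteLA : Subset → Set
CompleteLA S = ∀ φ → Sentence φ → ConstFree φ → (S ⌜ φ ⌝ ≡ true) ⊎ (S ⌜ `¬ φ ⌝ ≡ true)

data PAAxiom : Formula → Set where
  pa1 : PAAxiom (`∀ (`¬ (var 0 `+ `1 `= `0)))
  pa2 : PAAxiom (`∀ (`∀ (var 1 `+ `1 `= var 0 `+ `1 `→ var 1 `= var 0)))
  pa3 : PAAxiom (`∀ (var 0 `+ `0 `= var 0))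
  pa4 : PAAxiom (`∀ (`∀ (var 1 `+ (var 0 `+ `1) `= (var 1 `+ var 0) `+ `1)))
  pa5 : PAAxiom (`∀ (var 0 `* `0 `= `0))
  pa6 : PAAxiom (`∀ (`∀ (var 1 `* (var 0 `+ `1) `= var 1 `* var 0 `+ var 1)))
  pa7 : PAAxiom (`∀ (`∀ (var 1 `< var 0 `↔ `∃ (var 2 `+ var 0 `+ `1 `= var 1))))
  -- induction: φ(x, y₁..y_k) with x = var 0, parameters var 1 … var k
  ind : ∀ k φ → ConstFree φ → FVBelow (suc k) φ →
        PAAxiom (`∀^ k ((φ [ `0 ]) `∧ `∀ (φ `→ substF ((var 0 `+ `1) ∷ₛ (λ i → var (suc i))) φ)
                        `→ `∀ φ))

ExtendsPA : Subset → Set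
ExtendsPA T = ∀ φ → PAAxiom φ → T ⌜ φ ⌝ ≡ true

-- Equality is interpreted by a (possibly
-- non-identity) relation Eq, so that quotient structures are represented
-- by their set of representatives; quantifiers range over Dom.

record PreStructure : Set₁ where
  field
    A   : Set
    Dom : A → Set
    Eq  : A → A → Set
    Lt  : A → A → Set
    z   : A
    o   : A
    add : A → A → A
    mul : A → A → A

module _ (S : PreStructure) where
  open PreStructure S

  _∷ₑ_ : A → (ℕ → A) → ℕ → A
  (a ∷ₑ ρ) zero = a
  (a ∷ₑ ρ) (suc n) = ρ n

  -- κ interprets constant symbols, ρ variables
  evalT : (ℕ → A) → (ℕ → A) → Term → A
  evalT κ ρ (var n) = ρ n
  evalT κ ρ (con j) = κ j
  evalT κ ρ `0 = z
  evalT κ ρ `1 = o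
  evalT κ ρ (s `+ t) = add (evalT κ ρ s) (evalT κ ρ t)
  evalT κ ρ (s `* t) = mul (evalT κ ρ s) (evalT κ ρ t)

  Sat : (ℕ → A) → (ℕ → A) → Formula → Set
  Sat κ ρ (s `= t) = Eq (evalT κ ρ s) (evalT κ ρ t)
  Sat κ ρ (s `< t) = Lt (evalT κ ρ s) (evalT κ ρ t)
  Sat κ ρ `⊥ = ⊥
  Sat κ ρ (φ `∧ ψ) = Sat κ ρ φ × Sat κ ρ ψ
  Sat κ ρ (φ `∨ ψ) = Sat κ ρ φ ⊎ Sat κ ρ ψ
  Sat κ ρ (φ `→ ψ) = Sat κ ρ φ → Sat κ ρ ψ
  Sat κ ρ (`∀ φ) = (a : A) → Dom a → Sat κ (a ∷ₑ ρ) φ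
  Sat κ ρ (`∃ φ) = Σ A λ a → Dom a × Sat κ (a ∷ₑ ρ) φ

lookupℕ : {A : Set} {k : ℕ} → (Fin k → A) → A → ℕ → A
lookupℕ {k = zero} f d j = d
lookupℕ {k = suc k} f d zero = f fzero
lookupℕ {k = suc k} f d (suc j) = lookupℕ (λ i → f (fsuc i)) d j

cat : {A : Set} {n m : ℕ} → (Fin n → A) → (Fin m → A) → A → ℕ → A
cat {n = zero} b a d j = lookupℕ a d j
cat {n = suc n} b a d zero = b fzero
cat {n = suc n} b a d (suc j) = cat (λ i → b (fsuc i)) a d j

-- A type p(x̄, ā), x̄ = x₀…x_{n-1}, ā = a₀…a_{m-1}, is given by the set P of
-- codes of L_A-formulas φ(x̄, ȳ) with x_i = var i and y_i = var (n + i).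
-- Consistency with Th(S, ā): the set of L-sentences consisting of
--   Th(S, ā)  (sentences using only constants c_{n+i} naming a_i, true in S), and
--   p(c̄, c̄')  (each φ with x_i, y_i replaced by the constants c_i, c_{n+i})
-- is consistent.

module _ (S : PreStructure) where
  open PreStructure S

  paramEnv : {n m : ℕ} → (Fin m → A) → ℕ → A
  paramEnv {n} {m} a = cat {n = n} (λ _ → z) a z

  TypeTheory : (n m : ℕ) → (Fin m → A) → Subset → Formula → Set
  TypeTheory n m a P φ =
      (Sentence φ × AllConsts (λ j → (n ≤ j) × (j < n + m)) φ
                  × Sat S (paramEnv {n} {m} a) (λ _ → z) φ)
    ⊎ (Σ Formula λ ψ → (P ⌜ ψ ⌝ ≡ true) × (φ ≡ substF con ψ))

  RecursivelySaturated : Set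
  RecursivelySaturated =
    ∀ (n m : ℕ) (a : Fin m → A) → (∀ i → Dom (a i)) →
    (P : Subset) → Recursive P →
    (∀ k → P k ≡ true → Σ Formula λ ψ → (⌜ ψ ⌝ ≡ k) × ConstFree ψ × FVBelow (n + m) ψ) →
    Consistent (TypeTheory n m a P) →
    Σ (Fin n → A) λ b → (∀ i → Dom (b i)) ×
      (∀ ψ → P ⌜ ψ ⌝ ≡ true → Sat S (paramEnv {n} {m} a) (cat b a z) ψ)

record ScottSet (X : Subset → Set) : Set where
  field
    nonempty   : Σ Subset X
    union      : ∀ {A B} → X A → X B → X (λ n → A n ∨ B n)
    complement : ∀ {A} → X A → X (λ n → not (A n))
    turing     : ∀ {A B} → X B → A ≤T B → X A
    completion : ∀ S → X S → IsTheory S → Consistent (AxOf S) →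
                 Σ Subset λ S' → X S' × (S ⊆ˢ S') × IsTheory S' × Complete S'
                                 × Consistent (AxOf S')

record NonPrincipalUltrafilter (X : Subset → Set) (U : Subset → Set) : Set where
  field
    inX          : ∀ {A} → U A → X A
    full         : U (λ _ → true)
    empty∉       : ¬ U (λ _ → false)
    inter        : ∀ {A B} → U A → U B → U (λ n → A n ∧ B n)
    upward       : ∀ {A B} → U A → X B → A ⊆ˢ B → U B
    ultra        : ∀ {A} → X A → U A ⊎ U (λ n → not (A n))
    nonprincipal : ∀ {A} → U A → ¬ Finite A

record ωStructure : Set where
  field
    dom  : Subset
    z    : ℕ
    o    : ℕ
    add  : ℕ → ℕ → ℕ
    mul  : ℕ → ℕ → ℕ
    lt   : ℕ → ℕ → Bool
    z∈   : dom z ≡ true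
    o∈   : dom o ≡ true
    add∈ : ∀ {a b} → dom a ≡ true → dom b ≡ true → dom (add a b) ≡ true
    mul∈ : ∀ {a b} → dom a ≡ true → dom b ≡ true → dom (mul a b) ≡ true

asPre : ωStructure → PreStructure
asPre M = record
  { A = ℕ ; Dom = λ a → dom a ≡ true ; Eq = _≡_ ; Lt = λ a b → lt a b ≡ true
  ; z = z ; o = o ; add = add ; mul = mul }
  where open ωStructure M

Models : ωStructure → Subset → Set
Models M T = ∀ φ → T ⌜ φ ⌝ ≡ true → Sat (asPre M) (λ j → j) (λ _ → ωStructure.z M) φ

-- M is coded in X: its domain and its elementary diagram Th(M, a)_{a ∈ M}
-- (the constant c_a names a) belong to X
CodedIn : (Subset → Set) → ωStructure → Set
CodedIn X M =
  X (ωStructure.dom M) ×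
  Σ Subset λ D → X D ×
    (∀ k → D k ≡ true →
       Σ Formula λ φ → (⌜ φ ⌝ ≡ k) × Sentence φ
         × AllConsts (λ a → ωStructure.dom M a ≡ true) φ
         × Sat (asPre M) (λ j → j) (λ _ → ωStructure.z M) φ) ×
    (∀ φ → Sentence φ → AllConsts (λ a → ωStructure.dom M a ≡ true) φ →
       Sat (asPre M) (λ j → j) (λ _ → ωStructure.z M) φ → D ⌜ φ ⌝ ≡ true)

-- ∏_X M / U : elements are the f : ω → M with graph in X; equality and < hold
-- iff they hold on a set in U; operations are pointwise.
InProd : (Subset → Set) → ωStructure → (ℕ → ℕ) → Set
InProd X M f = (∀ n → ωStructure.dom M (f n) ≡ true) × X (graph f)

UltraProduct : (Subset → Set) → (Subset → Set) → ωStructure → PreStructure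
UltraProduct X U M = record
  { A = ℕ → ℕ
  ; Dom = InProd X M
  ; Eq = λ f g → U (λ n → f n ≡ᵇ g n)
  ; Lt = λ f g → U (λ n → lt (f n) (g n))
  ; z = λ _ → z ; o = λ _ → o
  ; add = λ f g n → add (f n) (g n)
  ; mul = λ f g n → mul (f n) (g n) }
  where open ωStructure M

-- Write K = ∏_X M / U. Since the elementary diagram D of M lies in X, satisfaction in M is
-- decidable relative to D, and a search through D bounded by any witness produces Skolem
-- functions computable from D and the given elements of K; their graphs lie in X because X is
-- closed under relative recursiveness. This proves Łoś's theorem for K:
-- K ⊨ φ(f̄) iff {n | M ⊨ φ(f̄(n))} ∈ U.
-- Let p(x̄, ā) be a recursive type consistent with Th(K, ā), and θ_j the conjunction of its
-- members with code below j. Consistency and Łoś give {t | M ⊨ ∃x̄ θ_j(x̄, ā(t))} ∈ U for each j.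
-- Let j(t) be the largest j ≤ t with M ⊨ ∃x̄ θ_j(x̄, ā(t)), and choose x̄(t) realizing θ_{j(t)} by
-- the same search. A member of p with code j holds at x̄(t) whenever j(t) > j, which is the case
-- for U-almost all t because U is non-principal; by Łoś, x̄ realizes p in K.

module Submission where

open import Defs
open import Data.Nat using (ℕ; zero; suc; _+_; _*_; _∸_; _≤_; _<_; _≡ᵇ_; z≤n; s≤s; pred)
open import Data.Nat.Properties
open import Data.Bool using (Bool; true; false; not; _∧_; _∨_; if_then_else_)
open import Data.Bool.Properties using (∨-zeroʳ; ∨-identityʳ; ∧-inverseʳ; ¬-not; not-involutive)
open import Data.Vec using (Vec; []; _∷_; head; tail; lookup)
open import Data.Fin using (Fin; toℕ) renaming (zero to fzero; suc to fsuc)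
open import Data.List using ([])
open import Data.Product using (Σ; _×_; _,_; proj₁; proj₂)
open import Data.Sum using (_⊎_; inj₁; inj₂) renaming ([_,_]′ to either)
open import Data.Unit using (tt)
open import Data.Empty using (⊥; ⊥-elim)
open import Function using (_⇔_; mk⇔; Equivalence; _∘_; _$_; case_of_)
open import Function.Construct.Identity using (⇔-id)
open import Function.Construct.Composition using (_⇔-∘_)
open import Function.Construct.Symmetry using (⇔-sym)
open import Data.Product.Function.NonDependent.Propositional using (_×-⇔_)
open import Data.Sum.Function.Propositional using (_⊎-⇔_)
open import Function.Related.TypeIsomorphisms using (→-cong-⇔)
open import Relation.Nullary
  using (¬_; Dec; _because_; yes; no; Reflects; ofʸ; ofⁿ; proof; det; _×-reflects_; _⊎-reflects_; _→-reflects_; ¬-reflects)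
open import Relation.Binary using (tri<; tri≈; tri>)
open import Relation.Binary.PropositionalEquality hiding ([_])

open Equivalence using (to; from)
reflects-true⇒ : ∀ {P : Set} {b} → Reflects P b → b ≡ true → P
reflects-true⇒ (ofʸ p) refl = p

reflects-⇒true : ∀ {P : Set} {b} → Reflects P b → P → b ≡ true
reflects-⇒true (ofʸ _) p = refl
reflects-⇒true (ofⁿ ¬p) p = ⊥-elim (¬p p)

≡ᵇ-reflects : ∀ x y → Reflects (x ≡ y) (x ≡ᵇ y)
≡ᵇ-reflects x y = proof (x ≟ y)

≡true-reflects : ∀ b → Reflects (b ≡ true) b
≡true-reflects true = ofʸ refl
≡true-reflects false = ofⁿ λ ()

⇔-reflects : ∀ {P : Set} {b} → (b ≡ true ⇔ P) → Reflects P b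
⇔-reflects {b = true} b⇔P = ofʸ (b⇔P .to refl)
⇔-reflects {b = false} b⇔P = ofⁿ λ p → case b⇔P .from p of λ ()

reflects-⇔ : ∀ {P Q : Set} {b} → P ⇔ Q → Reflects P b → Reflects Q b
reflects-⇔ P⇔Q (ofʸ p) = ofʸ (P⇔Q .to p)
reflects-⇔ P⇔Q (ofⁿ ¬p) = ofⁿ (¬p ∘ P⇔Q .from)

bit : Bool → ℕ
bit b = if b then 1 else 0

Computable : Subset → (k : ℕ) → (Vec ℕ k → ℕ) → Set
Computable B k f = Σ (Prog k) λ p → ∀ xs → Eval B p xs (f xs)

Computable₁ : Subset → (ℕ → ℕ) → Set
Computable₁ B f = Computable B 1 (λ xs → f (head xs))

Computable₂ : Subset → (ℕ → ℕ → ℕ) → Set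
Computable₂ B f = Computable B 2 (λ xs → f (head xs) (head (tail xs)))

ComputablePred : Subset → (k : ℕ) → (Vec ℕ k → Bool) → Set
ComputablePred B k p = Computable B k (λ xs → bit (p xs))

ComputableSet : Subset → Subset → Set
ComputableSet B A = Computable₁ B (λ n → bit (A n))

≤T⇒computableSet : ∀ {A B} → A ≤T B → ComputableSet B A
≤T⇒computableSet (p , ev) = p , λ { (n ∷ []) → ev n }

computableSet⇒≤T : ∀ {A B} → ComputableSet B A → A ≤T B
computableSet⇒≤T (p , ev) = p , λ n → ev (n ∷ [])

rec : ∀ {k} → (Vec ℕ k → ℕ) → (Vec ℕ (suc (suc k)) → ℕ) → Vec ℕ (suc k) → ℕ
rec g h (zero ∷ xs) = g xs
rec g h (suc n ∷ xs) = h (n ∷ rec g h (n ∷ xs) ∷ xs)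

module _ {B : Subset} where

  computable-ext : ∀ {k} {f g : Vec ℕ k → ℕ} → (∀ xs → f xs ≡ g xs) →
                   Computable B k f → Computable B k g
  computable-ext f≗g (p , ev) = p , λ xs → subst (Eval B p xs) (f≗g xs) (ev xs)

  zero-computable : ∀ {k} → Computable B k (λ _ → 0)
  zero-computable = pzero , λ _ → e-zero

  suc-computable : Computable₁ B suc
  suc-computable = psuc , λ { (x ∷ []) → e-suc }

  lookup-computable : ∀ {k} (i : Fin k) → Computable B k (λ xs → lookup xs i)
  lookup-computable i = proj i , λ _ → e-proj

  oracle-computable : ComputableSet B B
  oracle-computable = oracle , λ { (x ∷ []) → e-orc }

  ∘-computable₁ : ∀ {k} (f : ℕ → ℕ) {g : Vec ℕ k → ℕ} → Computable₁ B f → Computable B k g →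
                  Computable B k (λ xs → f (g xs))
  ∘-computable₁ _ (p , ep) (q , eq) = comp p (q ∷ []) , λ xs → e-comp (ev-∷ (eq xs) ev-[]) (ep _)

  ∘-computable₂ : ∀ {k} (f : ℕ → ℕ → ℕ) {g h : Vec ℕ k → ℕ} → Computable₂ B f →
                  Computable B k g → Computable B k h → Computable B k (λ xs → f (g xs) (h xs))
  ∘-computable₂ _ (p , ep) (q , eq) (r , er) =
    comp p (q ∷ r ∷ []) , λ xs → e-comp (ev-∷ (eq xs) (ev-∷ (er xs) ev-[])) (ep _)

  rec-computable : ∀ {k} {g : Vec ℕ k → ℕ} {h} → Computable B k g →
                   Computable B (suc (suc k)) h → Computable B (suc k) (rec g h)
  rec-computable {g = g} {h} (p , ep) (q , eq) = prec p q , λ { (n ∷ xs) → run n xs }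
    where
    run : ∀ n xs → Eval B (prec p q) (n ∷ xs) (rec g h (n ∷ xs))
    run zero xs = e-prec0 (ep xs)
    run (suc n) xs = e-precS (run n xs) (eq _)

  μ-computable : ∀ {k} {f : Vec ℕ (suc k) → ℕ} (w : Vec ℕ k → ℕ) → Computable B (suc k) f →
                 (∀ xs → f (w xs ∷ xs) ≡ 0) → (∀ xs i → i < w xs → Σ ℕ λ v → f (i ∷ xs) ≡ suc v) →
                 Computable B k w
  μ-computable w (p , ep) root below = pmu p , λ xs →
    e-mu (subst (Eval B p (w xs ∷ xs)) (root xs) (ep _))
         (λ i i<w → let (v , fi≡) = below xs i i<w in v , subst (Eval B p (i ∷ xs)) fi≡ (ep _))

  const-computable : ∀ {k} c → Computable B k (λ _ → c)
  const-computable zero = zero-computable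
  const-computable (suc c) = ∘-computable₁ suc suc-computable (const-computable c)

  x₀ : ∀ {k} → Computable B (suc k) head
  x₀ = computable-ext (λ { (x ∷ xs) → refl }) (lookup-computable fzero)

  x₁ : ∀ {k} → Computable B (suc (suc k)) (λ xs → head (tail xs))
  x₁ = computable-ext (λ { (x ∷ y ∷ xs) → refl }) (lookup-computable (fsuc fzero))

  x₂ : ∀ {k} → Computable B (suc (suc (suc k))) (λ xs → head (tail (tail xs)))
  x₂ = computable-ext (λ { (x ∷ y ∷ z ∷ xs) → refl }) (lookup-computable (fsuc (fsuc fzero)))

mutual
  relativize : ∀ {k} → Prog 1 → Prog k → Prog k
  relativize q pzero = pzero
  relativize q psuc = psuc
  relativize q (proj i) = proj i
  relativize q (comp f gs) = comp (relativize q f) (relativizeVec q gs)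
  relativize q (prec g h) = prec (relativize q g) (relativize q h)
  relativize q (pmu f) = pmu (relativize q f)
  relativize q oracle = q

  relativizeVec : ∀ {k m} → Prog 1 → Vec (Prog k) m → Vec (Prog k) m
  relativizeVec q [] = []
  relativizeVec q (g ∷ gs) = relativize q g ∷ relativizeVec q gs

module _ {B C : Subset} (q : Prog 1) (q-evals-B : ∀ x → Eval C q (x ∷ []) (bit (B x))) where
  mutual
    relativize-eval : ∀ {k} {p : Prog k} {xs y} → Eval B p xs y → Eval C (relativize q p) xs y
    relativize-eval e-zero = e-zero
    relativize-eval e-suc = e-suc
    relativize-eval e-proj = e-proj
    relativize-eval (e-comp evs e) = e-comp (relativize-evalVec evs) (relativize-eval e)
    relativize-eval (e-prec0 e) = e-prec0 (relativize-eval e)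
    relativize-eval (e-precS e e') = e-precS (relativize-eval e) (relativize-eval e')
    relativize-eval (e-mu e below) = e-mu (relativize-eval e) (λ i i<n → relativize-below (below i i<n))
    relativize-eval (e-orc {x}) = q-evals-B x

    relativize-below : ∀ {k} {p : Prog (suc k)} {i xs} → Σ ℕ (λ v → Eval B p (i ∷ xs) (suc v)) →
                       Σ ℕ (λ v → Eval C (relativize q p) (i ∷ xs) (suc v))
    relativize-below (v , e) = v , relativize-eval e

    relativize-evalVec : ∀ {k m} {gs : Vec (Prog k) m} {xs ys} → EvalVec B gs xs ys →
                         EvalVec C (relativizeVec q gs) xs ys
    relativize-evalVec ev-[] = ev-[]
    relativize-evalVec (ev-∷ e es) = ev-∷ (relativize-eval e) (relativize-evalVec es)

computable-trans : ∀ {B C k} {f : Vec ℕ k → ℕ} → ComputableSet C B → Computable B k f → Computable C k f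
computable-trans (q , q-ev) (p , ev) = relativize q p , λ xs → relativize-eval q (λ x → q-ev (x ∷ [])) (ev xs)

module _ {B : Subset} where

  +-computable : Computable₂ B _+_
  +-computable = computable-ext (λ { (a ∷ b ∷ []) → rec≡+ a b }) (rec-computable x₀ (∘-computable₁ suc suc-computable x₁))
    where
    rec≡+ : ∀ a b → rec head (λ xs → suc (head (tail xs))) (a ∷ b ∷ []) ≡ a + b
    rec≡+ zero b = refl
    rec≡+ (suc a) b = cong suc (rec≡+ a b)

  *-computable : Computable₂ B _*_
  *-computable = computable-ext (λ { (a ∷ b ∷ []) → rec≡* a b })
    (rec-computable zero-computable (∘-computable₂ _+_ +-computable x₂ x₁))
    where
    rec≡* : ∀ a b → rec (λ _ → 0) (λ xs → head (tail (tail xs)) + head (tail xs)) (a ∷ b ∷ []) ≡ a * b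
    rec≡* zero b = refl
    rec≡* (suc a) b = cong (b +_) (rec≡* a b)

  pred-computable : Computable₁ B pred
  pred-computable = computable-ext (λ { (zero ∷ []) → refl ; (suc a ∷ []) → refl })
    (rec-computable {g = λ _ → 0} {h = head} zero-computable x₀)

  ∸-computable : Computable₂ B _∸_
  ∸-computable = computable-ext (λ { (a ∷ b ∷ []) → rec≡∸ b a })
    (∘-computable₂ (λ b a → rec head (λ xs → pred (head (tail xs))) (b ∷ a ∷ []))
      (computable-ext (λ { (b ∷ a ∷ []) → refl }) (rec-computable x₀ (∘-computable₁ pred pred-computable x₁))) x₁ x₀)
    where
    rec≡∸ : ∀ b a → rec head (λ xs → pred (head (tail xs))) (b ∷ a ∷ []) ≡ a ∸ b
    rec≡∸ zero a = refl
    rec≡∸ (suc b) a = trans (cong pred (rec≡∸ b a)) (pred[m∸n]≡m∸[1+n] a b)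

  tri-computable : Computable₁ B tri
  tri-computable = computable-ext (λ { (a ∷ []) → rec≡tri a })
    (rec-computable zero-computable (∘-computable₂ _+_ +-computable (∘-computable₁ suc suc-computable x₀) x₁))
    where
    rec≡tri : ∀ a → rec (λ _ → 0) (λ xs → suc (head xs) + head (tail xs)) (a ∷ []) ≡ tri a
    rec≡tri zero = refl
    rec≡tri (suc a) = cong (suc a +_) (rec≡tri a)

  pair-computable : Computable₂ B pair
  pair-computable = ∘-computable₂ _+_ +-computable (∘-computable₁ tri tri-computable (∘-computable₂ _+_ +-computable x₀ x₁)) x₀

module _ {B : Subset} where

  not-computable : ∀ {k} {p : Vec ℕ k → Bool} → ComputablePred B k p → ComputablePred B k (λ xs → not (p xs))
  not-computable {p = p} cp = computable-ext (λ xs → 1∸bit (p xs)) (∘-computable₂ _∸_ ∸-computable (const-computable 1) cp)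
    where
    1∸bit : ∀ b → 1 ∸ bit b ≡ bit (not b)
    1∸bit true = refl
    1∸bit false = refl

  ∧-computable : ∀ {k} {p q : Vec ℕ k → Bool} → ComputablePred B k p → ComputablePred B k q →
                 ComputablePred B k (λ xs → p xs ∧ q xs)
  ∧-computable {p = p} {q} cp cq = computable-ext (λ xs → bit*bit (p xs) (q xs)) (∘-computable₂ _*_ *-computable cp cq)
    where
    bit*bit : ∀ a b → bit a * bit b ≡ bit (a ∧ b)
    bit*bit true true = refl
    bit*bit true false = refl
    bit*bit false b = refl

  ∨-computable : ∀ {k} {p q : Vec ℕ k → Bool} → ComputablePred B k p → ComputablePred B k q →
                 ComputablePred B k (λ xs → p xs ∨ q xs)
  ∨-computable {p = p} {q} cp cq =
    computable-ext (λ xs → cong bit (de-morgan (p xs) (q xs))) (not-computable (∧-computable (not-computable cp) (not-computable cq)))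
    where
    de-morgan : ∀ a b → not (not a ∧ not b) ≡ a ∨ b
    de-morgan true b = refl
    de-morgan false b = not-involutive b

  ≡ᵇ-computable : ∀ {k} {f g : Vec ℕ k → ℕ} → Computable B k f → Computable B k g →
                  ComputablePred B k (λ xs → f xs ≡ᵇ g xs)
  ≡ᵇ-computable {f = f} {g} cf cg =
    computable-ext (λ xs → distance≡bit (f xs) (g xs))
      (∘-computable₂ _∸_ ∸-computable (const-computable 1)
        (∘-computable₂ _+_ +-computable (∘-computable₂ _∸_ ∸-computable cf cg) (∘-computable₂ _∸_ ∸-computable cg cf)))
    where
    distance≡bit : ∀ x y → 1 ∸ ((x ∸ y) + (y ∸ x)) ≡ bit (x ≡ᵇ y)
    distance≡bit zero zero = refl
    distance≡bit zero (suc y) = 0∸n≡0 y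
    distance≡bit (suc x) zero = trans (cong (1 ∸_) (+-identityʳ (suc x))) (0∸n≡0 x)
    distance≡bit (suc x) (suc y) = distance≡bit x y

  if-computable : ∀ {k} {p : Vec ℕ k → Bool} {f g : Vec ℕ k → ℕ} → ComputablePred B k p →
                  Computable B k f → Computable B k g → Computable B k (λ xs → if p xs then f xs else g xs)
  if-computable {p = p} {f} {g} cp cf cg =
    computable-ext (λ xs → select (p xs) (f xs) (g xs))
      (∘-computable₂ _+_ +-computable (∘-computable₂ _*_ *-computable cp cf) (∘-computable₂ _*_ *-computable (not-computable cp) cg))
    where
    select : ∀ b x y → bit b * x + bit (not b) * y ≡ (if b then x else y)
    select true x y = trans (+-identityʳ (x + 0)) (+-identityʳ x)
    select false x y = +-identityʳ y

  ∈-computable : ∀ {k} (A : Subset) {f : Vec ℕ k → ℕ} → ComputableSet B A → Computable B k f →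
                 ComputablePred B k (λ xs → A (f xs))
  ∈-computable A = ∘-computable₁ (λ n → bit (A n))

isEven : ℕ → Bool
isEven zero = true
isEven (suc x) = not (isEven x)

half : ℕ → ℕ
half zero = 0
half (suc x) = half x + bit (not (isEven x))

infixr 5 _⊕_
_⊕_ : Subset → Subset → Subset
(A ⊕ C) n = (isEven n ∧ A (half n)) ∨ (not (isEven n) ∧ C (half n))

isEven-double : ∀ x → isEven (x + x) ≡ true
isEven-double zero = refl
isEven-double (suc x) rewrite +-suc x x | isEven-double x = refl

half-double : ∀ x → half (x + x) ≡ x
half-double zero = refl
half-double (suc x) rewrite +-suc x x | isEven-double x | half-double x | +-identityʳ x = +-comm x 1

⊕-even : ∀ A C x → (A ⊕ C) (x + x) ≡ A x
⊕-even A C x rewrite isEven-double x | half-double x = ∨-identityʳ (A x)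

⊕-odd : ∀ A C x → (A ⊕ C) (suc (x + x)) ≡ C x
⊕-odd A C x rewrite isEven-double x | half-double x | +-identityʳ x = refl

module _ {B : Subset} where

  isEven-computable : ComputableSet B isEven
  isEven-computable = computable-ext (λ { (a ∷ []) → rec≡isEven a })
    (rec-computable (const-computable 1) (∘-computable₂ _∸_ ∸-computable (const-computable 1) x₁))
    where
    rec≡isEven : ∀ a → rec (λ _ → 1) (λ xs → 1 ∸ head (tail xs)) (a ∷ []) ≡ bit (isEven a)
    rec≡isEven zero = refl
    rec≡isEven (suc a) with isEven a | rec≡isEven a
    ... | true | e = cong (1 ∸_) e
    ... | false | e = cong (1 ∸_) e

  half-computable : Computable₁ B half
  half-computable = computable-ext (λ { (a ∷ []) → rec≡half a })
    (rec-computable zero-computable (∘-computable₂ _+_ +-computable x₁ (not-computable (∈-computable isEven isEven-computable x₀))))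
    where
    rec≡half : ∀ a → rec (λ _ → 0) (λ xs → head (tail xs) + bit (not (isEven (head xs)))) (a ∷ []) ≡ half a
    rec≡half zero = refl
    rec≡half (suc a) = cong (_+ bit (not (isEven a))) (rec≡half a)

⊕-computableˡ : ∀ A C → ComputableSet (A ⊕ C) A
⊕-computableˡ A C = computable-ext (λ { (x ∷ []) → cong bit (⊕-even A C x) })
  (∈-computable (A ⊕ C) oracle-computable (∘-computable₂ _+_ +-computable x₀ x₀))

⊕-computableʳ : ∀ A C → ComputableSet (A ⊕ C) C
⊕-computableʳ A C = computable-ext (λ { (x ∷ []) → cong bit (⊕-odd A C x) })
  (∈-computable (A ⊕ C) oracle-computable (∘-computable₁ suc suc-computable (∘-computable₂ _+_ +-computable x₀ x₀)))

tri-mono : ∀ {s s'} → s ≤ s' → tri s ≤ tri s'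
tri-mono {zero} _ = z≤n
tri-mono {suc s} {suc s'} (s≤s s≤s') = +-mono-≤ (s≤s s≤s') (tri-mono s≤s')

pair<tri : ∀ a b {s} → a + b < s → pair a b < tri s
pair<tri a b {s} a+b<s = begin-strict
    tri (a + b) + a        ≤⟨ +-monoʳ-≤ (tri (a + b)) (m≤m+n a b) ⟩
    tri (a + b) + (a + b)  <⟨ s≤s (≤-reflexive (+-comm (tri (a + b)) (a + b))) ⟩
    tri (suc (a + b))      ≤⟨ tri-mono a+b<s ⟩
    tri s                  ∎
  where open ≤-Reasoning

-- The diagonal a + b is recovered first: pairs on later diagonals are strictly larger.
pair-injective : ∀ {a b a' b'} → pair a b ≡ pair a' b' → a ≡ a' × b ≡ b'
pair-injective {a} {b} {a'} {b'} e with <-cmp (a + b) (a' + b')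
... | tri< lt _ _ = ⊥-elim (<-irrefl e (<-≤-trans (pair<tri a b lt) (m≤m+n _ a')))
... | tri> _ _ gt = ⊥-elim (<-irrefl (sym e) (<-≤-trans (pair<tri a' b' gt) (m≤m+n _ a)))
... | tri≈ _ same-diagonal _ = a≡a' , +-cancelˡ-≡ a b b' (trans same-diagonal (cong (_+ b') (sym a≡a')))
  where
  a≡a' : a ≡ a'
  a≡a' = +-cancelˡ-≡ (tri (a + b)) a a' (trans e (cong (λ s → tri s + a') (sym same-diagonal)))

≤-pair : ∀ n m → n ≤ pair n m
≤-pair n m = m≤n+m n (tri (n + m))

anyUpTo-intro : ∀ k (p : ℕ → Bool) i → i ≤ k → p i ≡ true → anyUpTo k p ≡ true
anyUpTo-intro zero p .zero z≤n pi = pi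
anyUpTo-intro (suc k) p i i≤1+k pi with m≤n⇒m<n∨m≡n i≤1+k
... | inj₁ (s≤s i≤k) rewrite anyUpTo-intro k p i i≤k pi = refl
... | inj₂ refl rewrite pi = ∨-zeroʳ (anyUpTo k p)

anyUpTo-elim : ∀ k (p : ℕ → Bool) → anyUpTo k p ≡ true → Σ ℕ λ i → i ≤ k × p i ≡ true
anyUpTo-elim zero p e = zero , z≤n , e
anyUpTo-elim (suc k) p e with anyUpTo k p in earlier
... | true = let (i , i≤k , pi) = anyUpTo-elim k p earlier in i , m≤n⇒m≤1+n i≤k , pi
... | false = suc k , ≤-refl , e

graph-∋ : ∀ f n → graph f (pair n (f n)) ≡ true
graph-∋ f n = anyUpTo-intro _ _ n (≤-pair n (f n)) (reflects-⇒true (≡ᵇ-reflects (pair n (f n)) _) refl)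

graph-functional : ∀ f n m → graph f (pair n m) ≡ true → m ≡ f n
graph-functional f n m e with anyUpTo-elim (pair n m) (λ i → pair i (f i) ≡ᵇ pair n m) e
... | i , _ , hit with pair-injective {i} {f i} {n} {m} (reflects-true⇒ (≡ᵇ-reflects _ _) hit)
... | refl , fn≡m = sym fn≡m

graph-∌ : ∀ f n m → m ≢ f n → graph f (pair n m) ≡ false
graph-∌ f n m m≢fn = ¬-not (λ e → m≢fn (graph-functional f n m e))

search : (ℕ → Bool) → ℕ → ℕ
search p zero = zero
search p (suc b) = if p zero then zero else suc (search (λ i → p (suc i)) b)

search-sound : ∀ (p : ℕ → Bool) b → p b ≡ true → p (search p b) ≡ true
search-sound p zero pb = pb
search-sound p (suc b) pb with p zero in p0
... | true = p0
... | false = search-sound (λ i → p (suc i)) b pb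

search-least : ∀ (p : ℕ → Bool) b i → i < search p b → p i ≡ false
search-least p (suc b) i i<s with p zero in p0
search-least p (suc b) zero i<s | false = p0
search-least p (suc b) (suc i) (s≤s i<s) | false = search-least (λ i → p (suc i)) b i i<s

module _ {B : Subset} where

  search-computable : ∀ (p : ℕ → ℕ → Bool) → Computable B 2 (λ xs → bit (p (head xs) (head (tail xs)))) →
                      (bound : ℕ → ℕ) → (∀ n → p (bound n) n ≡ true) →
                      Computable₁ B (λ n → search (λ c → p c n) (bound n))
  search-computable p cp bound p-bound =
    μ-computable _ (∘-computable₂ _∸_ ∸-computable (const-computable 1) cp)
      (λ { (n ∷ []) → cong (λ b → 1 ∸ bit b) (search-sound (λ c → p c n) (bound n) (p-bound n)) })
      (λ { (n ∷ []) i i<s → 0 , cong (λ b → 1 ∸ bit b) (search-least (λ c → p c n) (bound n) i i<s) })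

  graph-computable : ∀ {f} → Computable₁ B f → ComputableSet B (graph f)
  graph-computable {f} cf = computable-ext (λ { (k ∷ []) → rec≡anyUpTo k k }) (∘-computable₂ anyHitUpTo upTo x₀ x₀)
    where
    hit : ℕ → ℕ → Bool
    hit k i = pair i (f i) ≡ᵇ k
    step : Vec ℕ 3 → ℕ
    step (j ∷ r ∷ k ∷ []) = bit ((r ≡ᵇ 1) ∨ hit k (suc j))
    anyHitUpTo : ℕ → ℕ → ℕ
    anyHitUpTo j k = rec (λ xs → bit (hit (head xs) 0)) step (j ∷ k ∷ [])
    upTo : Computable₂ B anyHitUpTo
    upTo = computable-ext (λ { (j ∷ k ∷ []) → refl }) $ rec-computable
      (≡ᵇ-computable (∘-computable₂ pair pair-computable (const-computable 0) (∘-computable₁ f cf (const-computable 0))) x₀)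
      (computable-ext (λ { (j ∷ r ∷ k ∷ []) → refl })
        (∨-computable (≡ᵇ-computable x₁ (const-computable 1))
          (≡ᵇ-computable (∘-computable₂ pair pair-computable (∘-computable₁ suc suc-computable x₀)
                           (∘-computable₁ f cf (∘-computable₁ suc suc-computable x₀))) x₂)))
    bit≡ᵇ1 : ∀ b → (bit b ≡ᵇ 1) ≡ b
    bit≡ᵇ1 true = refl
    bit≡ᵇ1 false = refl
    rec≡anyUpTo : ∀ j k → anyHitUpTo j k ≡ bit (anyUpTo j (hit k))
    rec≡anyUpTo zero k = refl
    rec≡anyUpTo (suc j) k rewrite rec≡anyUpTo j k | bit≡ᵇ1 (anyUpTo j (hit k)) = refl

graph-decodable : ∀ {f} → Computable₁ (graph f) f
graph-decodable {f} = μ-computable _ (∘-computable₂ _∸_ ∸-computable (const-computable 1)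
                                        (∈-computable (graph f) oracle-computable (∘-computable₂ pair pair-computable x₁ x₀)))
  (λ { (n ∷ []) → cong (λ b → 1 ∸ bit b) (graph-∋ f n) })
  (λ { (n ∷ []) i i<fn → 0 , cong (λ b → 1 ∸ bit b) (graph-∌ f n i (λ e → <-irrefl e i<fn)) })

graphs : ∀ m → (Fin m → ℕ → ℕ) → Subset
graphs zero a = λ _ → false
graphs (suc m) a = graph (a fzero) ⊕ graphs m (a ∘ fsuc)

graphs-computes : ∀ m a i → Computable₁ (graphs m a) (a i)
graphs-computes (suc m) a fzero = computable-trans (⊕-computableˡ (graph (a fzero)) (graphs m (a ∘ fsuc))) graph-decodable
graphs-computes (suc m) a (fsuc i) = computable-trans (⊕-computableʳ (graph (a fzero)) (graphs m (a ∘ fsuc))) (graphs-computes m (a ∘ fsuc) i)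

tagᵗ : Term → ℕ
tagᵗ (var _) = 0
tagᵗ (con _) = 1
tagᵗ `0 = 2
tagᵗ `1 = 3
tagᵗ (_ `+ _) = 4
tagᵗ (_ `* _) = 5

bodyᵗ : Term → ℕ
bodyᵗ (var n) = n
bodyᵗ (con n) = n
bodyᵗ `0 = 0
bodyᵗ `1 = 0
bodyᵗ (s `+ t) = pair ⌜ s ⌝ᵗ ⌜ t ⌝ᵗ
bodyᵗ (s `* t) = pair ⌜ s ⌝ᵗ ⌜ t ⌝ᵗ

⌜⌝ᵗ-tag-body : ∀ t → ⌜ t ⌝ᵗ ≡ pair (tagᵗ t) (bodyᵗ t)
⌜⌝ᵗ-tag-body (var _) = refl
⌜⌝ᵗ-tag-body (con _) = refl
⌜⌝ᵗ-tag-body `0 = refl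
⌜⌝ᵗ-tag-body `1 = refl
⌜⌝ᵗ-tag-body (_ `+ _) = refl
⌜⌝ᵗ-tag-body (_ `* _) = refl

⌜⌝ᵗ-injective : ∀ s t → ⌜ s ⌝ᵗ ≡ ⌜ t ⌝ᵗ → s ≡ t
⌜⌝ᵗ-injective s t e = same-tag-body s t (pair-injective (trans (sym (⌜⌝ᵗ-tag-body s)) (trans e (⌜⌝ᵗ-tag-body t))))
  where
  -- Terms with different tags are ruled out by the pattern refl on the tag equation.
  same-tag-body : ∀ s t → tagᵗ s ≡ tagᵗ t × bodyᵗ s ≡ bodyᵗ t → s ≡ t
  same-tag-body (var n) (var .n) (refl , refl) = refl
  same-tag-body (con n) (con .n) (refl , refl) = refl
  same-tag-body `0 `0 _ = refl
  same-tag-body `1 `1 _ = refl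
  same-tag-body (s `+ s') (t `+ t') (refl , e) =
    let (e₁ , e₂) = pair-injective e in cong₂ _`+_ (⌜⌝ᵗ-injective s t e₁) (⌜⌝ᵗ-injective s' t' e₂)
  same-tag-body (s `* s') (t `* t') (refl , e) =
    let (e₁ , e₂) = pair-injective e in cong₂ _`*_ (⌜⌝ᵗ-injective s t e₁) (⌜⌝ᵗ-injective s' t' e₂)

tag : Formula → ℕ
tag (_ `= _) = 0
tag (_ `< _) = 1
tag `⊥ = 2
tag (_ `∧ _) = 3
tag (_ `∨ _) = 4
tag (_ `→ _) = 5
tag (`∀ _) = 6
tag (`∃ _) = 7

body : Formula → ℕ
body (s `= t) = pair ⌜ s ⌝ᵗ ⌜ t ⌝ᵗ
body (s `< t) = pair ⌜ s ⌝ᵗ ⌜ t ⌝ᵗ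
body `⊥ = 0
body (φ `∧ ψ) = pair ⌜ φ ⌝ ⌜ ψ ⌝
body (φ `∨ ψ) = pair ⌜ φ ⌝ ⌜ ψ ⌝
body (φ `→ ψ) = pair ⌜ φ ⌝ ⌜ ψ ⌝
body (`∀ φ) = ⌜ φ ⌝
body (`∃ φ) = ⌜ φ ⌝

⌜⌝-tag-body : ∀ φ → ⌜ φ ⌝ ≡ pair (tag φ) (body φ)
⌜⌝-tag-body (_ `= _) = refl
⌜⌝-tag-body (_ `< _) = refl
⌜⌝-tag-body `⊥ = refl
⌜⌝-tag-body (_ `∧ _) = refl
⌜⌝-tag-body (_ `∨ _) = refl
⌜⌝-tag-body (_ `→ _) = refl
⌜⌝-tag-body (`∀ _) = refl
⌜⌝-tag-body (`∃ _) = refl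

⌜⌝-injective : ∀ φ ψ → ⌜ φ ⌝ ≡ ⌜ ψ ⌝ → φ ≡ ψ
⌜⌝-injective φ ψ e = same-tag-body φ ψ (pair-injective (trans (sym (⌜⌝-tag-body φ)) (trans e (⌜⌝-tag-body ψ))))
  where
  terms : ∀ s s' t t' → pair ⌜ s ⌝ᵗ ⌜ s' ⌝ᵗ ≡ pair ⌜ t ⌝ᵗ ⌜ t' ⌝ᵗ → s ≡ t × s' ≡ t'
  terms s s' t t' e = let (e₁ , e₂) = pair-injective e in ⌜⌝ᵗ-injective s t e₁ , ⌜⌝ᵗ-injective s' t' e₂
  formulas : ∀ φ φ' ψ ψ' → pair ⌜ φ ⌝ ⌜ φ' ⌝ ≡ pair ⌜ ψ ⌝ ⌜ ψ' ⌝ → φ ≡ ψ × φ' ≡ ψ'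
  formulas φ φ' ψ ψ' e = let (e₁ , e₂) = pair-injective e in ⌜⌝-injective φ ψ e₁ , ⌜⌝-injective φ' ψ' e₂
  same-tag-body : ∀ φ ψ → tag φ ≡ tag ψ × body φ ≡ body ψ → φ ≡ ψ
  same-tag-body (s `= s') (t `= t') (refl , e) with refl , refl ← terms s s' t t' e = refl
  same-tag-body (s `< s') (t `< t') (refl , e) with refl , refl ← terms s s' t t' e = refl
  same-tag-body `⊥ `⊥ _ = refl
  same-tag-body (φ `∧ φ') (ψ `∧ ψ') (refl , e) with refl , refl ← formulas φ φ' ψ ψ' e = refl
  same-tag-body (φ `∨ φ') (ψ `∨ ψ') (refl , e) with refl , refl ← formulas φ φ' ψ ψ' e = refl
  same-tag-body (φ `→ φ') (ψ `→ ψ') (refl , e) with refl , refl ← formulas φ φ' ψ ψ' e = refl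
  same-tag-body (`∀ φ) (`∀ ψ) (refl , e) = cong `∀ (⌜⌝-injective φ ψ e)
  same-tag-body (`∃ φ) (`∃ ψ) (refl , e) = cong `∃ (⌜⌝-injective φ ψ e)

ConstFreeᵗ⇒AllConstsᵗ : ∀ (Q : ℕ → Set) t → AllConstsᵗ (λ _ → ⊥) t → AllConstsᵗ Q t
ConstFreeᵗ⇒AllConstsᵗ Q (var _) _ = tt
ConstFreeᵗ⇒AllConstsᵗ Q (con _) ()
ConstFreeᵗ⇒AllConstsᵗ Q `0 _ = tt
ConstFreeᵗ⇒AllConstsᵗ Q `1 _ = tt
ConstFreeᵗ⇒AllConstsᵗ Q (s `+ t) (cs , ct) = ConstFreeᵗ⇒AllConstsᵗ Q s cs , ConstFreeᵗ⇒AllConstsᵗ Q t ct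
ConstFreeᵗ⇒AllConstsᵗ Q (s `* t) (cs , ct) = ConstFreeᵗ⇒AllConstsᵗ Q s cs , ConstFreeᵗ⇒AllConstsᵗ Q t ct

ConstFree⇒AllConsts : ∀ (Q : ℕ → Set) φ → ConstFree φ → AllConsts Q φ
ConstFree⇒AllConsts Q (s `= t) (cs , ct) = ConstFreeᵗ⇒AllConstsᵗ Q s cs , ConstFreeᵗ⇒AllConstsᵗ Q t ct
ConstFree⇒AllConsts Q (s `< t) (cs , ct) = ConstFreeᵗ⇒AllConstsᵗ Q s cs , ConstFreeᵗ⇒AllConstsᵗ Q t ct
ConstFree⇒AllConsts Q `⊥ _ = tt
ConstFree⇒AllConsts Q (φ `∧ ψ) (cφ , cψ) = ConstFree⇒AllConsts Q φ cφ , ConstFree⇒AllConsts Q ψ cψ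
ConstFree⇒AllConsts Q (φ `∨ ψ) (cφ , cψ) = ConstFree⇒AllConsts Q φ cφ , ConstFree⇒AllConsts Q ψ cψ
ConstFree⇒AllConsts Q (φ `→ ψ) (cφ , cψ) = ConstFree⇒AllConsts Q φ cφ , ConstFree⇒AllConsts Q ψ cψ
ConstFree⇒AllConsts Q (`∀ φ) cφ = ConstFree⇒AllConsts Q φ cφ
ConstFree⇒AllConsts Q (`∃ φ) cφ = ConstFree⇒AllConsts Q φ cφ

Subst : Set
Subst = ℕ → Term

substT-fusion : ∀ (σ τ : Subst) t → substT τ (substT σ t) ≡ substT (λ i → substT τ (σ i)) t
substT-fusion σ τ (var n) = refl
substT-fusion σ τ (con j) = refl
substT-fusion σ τ `0 = refl
substT-fusion σ τ `1 = refl
substT-fusion σ τ (s `+ t) = cong₂ _`+_ (substT-fusion σ τ s) (substT-fusion σ τ t)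
substT-fusion σ τ (s `* t) = cong₂ _`*_ (substT-fusion σ τ s) (substT-fusion σ τ t)

substT-cong : ∀ {σ τ : Subst} → (∀ i → σ i ≡ τ i) → ∀ t → substT σ t ≡ substT τ t
substT-cong σ≗τ (var n) = σ≗τ n
substT-cong σ≗τ (con j) = refl
substT-cong σ≗τ `0 = refl
substT-cong σ≗τ `1 = refl
substT-cong σ≗τ (s `+ t) = cong₂ _`+_ (substT-cong σ≗τ s) (substT-cong σ≗τ t)
substT-cong σ≗τ (s `* t) = cong₂ _`*_ (substT-cong σ≗τ s) (substT-cong σ≗τ t)

substT-var : ∀ t → substT var t ≡ t
substT-var (var n) = refl
substT-var (con j) = refl
substT-var `0 = refl
substT-var `1 = refl
substT-var (s `+ t) = cong₂ _`+_ (substT-var s) (substT-var t)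
substT-var (s `* t) = cong₂ _`*_ (substT-var s) (substT-var t)

liftS-cong : ∀ {σ τ : Subst} → (∀ i → σ i ≡ τ i) → ∀ i → liftS σ i ≡ liftS τ i
liftS-cong σ≗τ zero = refl
liftS-cong σ≗τ (suc i) = cong (substT (λ i → var (suc i))) (σ≗τ i)

substF-cong : ∀ {σ τ : Subst} → (∀ i → σ i ≡ τ i) → ∀ φ → substF σ φ ≡ substF τ φ
substF-cong σ≗τ (s `= t) = cong₂ _`=_ (substT-cong σ≗τ s) (substT-cong σ≗τ t)
substF-cong σ≗τ (s `< t) = cong₂ _`<_ (substT-cong σ≗τ s) (substT-cong σ≗τ t)
substF-cong σ≗τ `⊥ = refl
substF-cong σ≗τ (φ `∧ ψ) = cong₂ _`∧_ (substF-cong σ≗τ φ) (substF-cong σ≗τ ψ)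
substF-cong σ≗τ (φ `∨ ψ) = cong₂ _`∨_ (substF-cong σ≗τ φ) (substF-cong σ≗τ ψ)
substF-cong σ≗τ (φ `→ ψ) = cong₂ _`→_ (substF-cong σ≗τ φ) (substF-cong σ≗τ ψ)
substF-cong σ≗τ (`∀ φ) = cong `∀ (substF-cong (liftS-cong σ≗τ) φ)
substF-cong σ≗τ (`∃ φ) = cong `∃ (substF-cong (liftS-cong σ≗τ) φ)

liftS-fusion : ∀ (σ τ : Subst) i → substT (liftS τ) (liftS σ i) ≡ liftS (λ j → substT τ (σ j)) i
liftS-fusion σ τ zero = refl
liftS-fusion σ τ (suc i) =
  trans (substT-fusion (λ j → var (suc j)) (liftS τ) (σ i)) (sym (substT-fusion τ (λ j → var (suc j)) (σ i)))

substF-fusion : ∀ (σ τ : Subst) φ → substF τ (substF σ φ) ≡ substF (λ i → substT τ (σ i)) φ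
substF-fusion σ τ (s `= t) = cong₂ _`=_ (substT-fusion σ τ s) (substT-fusion σ τ t)
substF-fusion σ τ (s `< t) = cong₂ _`<_ (substT-fusion σ τ s) (substT-fusion σ τ t)
substF-fusion σ τ `⊥ = refl
substF-fusion σ τ (φ `∧ ψ) = cong₂ _`∧_ (substF-fusion σ τ φ) (substF-fusion σ τ ψ)
substF-fusion σ τ (φ `∨ ψ) = cong₂ _`∨_ (substF-fusion σ τ φ) (substF-fusion σ τ ψ)
substF-fusion σ τ (φ `→ ψ) = cong₂ _`→_ (substF-fusion σ τ φ) (substF-fusion σ τ ψ)
substF-fusion σ τ (`∀ φ) = cong `∀ (trans (substF-fusion (liftS σ) (liftS τ) φ) (substF-cong (liftS-fusion σ τ) φ))
substF-fusion σ τ (`∃ φ) = cong `∃ (trans (substF-fusion (liftS σ) (liftS τ) φ) (substF-cong (liftS-fusion σ τ) φ))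

substF-liftS-[] : ∀ (τ : Subst) t φ → (substF (liftS τ) φ) [ t ] ≡ substF (t ∷ₛ τ) φ
substF-liftS-[] τ t φ = trans (substF-fusion (liftS τ) (t ∷ₛ var) φ) (substF-cong pointwise φ)
  where
  pointwise : ∀ i → substT (t ∷ₛ var) (liftS τ i) ≡ (t ∷ₛ τ) i
  pointwise zero = refl
  pointwise (suc i) = trans (substT-fusion (λ j → var (suc j)) (t ∷ₛ var) (τ i)) (substT-var (τ i))

substT-FVBelow : ∀ {k k'} (σ : Subst) t → FVBelowᵗ k t → (∀ i → i < k → FVBelowᵗ k' (σ i)) →
                 FVBelowᵗ k' (substT σ t)
substT-FVBelow σ (var n) n<k σ-ok = σ-ok n n<k
substT-FVBelow σ (con j) _ σ-ok = tt
substT-FVBelow σ `0 _ σ-ok = tt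
substT-FVBelow σ `1 _ σ-ok = tt
substT-FVBelow σ (s `+ t) (fs , ft) σ-ok = substT-FVBelow σ s fs σ-ok , substT-FVBelow σ t ft σ-ok
substT-FVBelow σ (s `* t) (fs , ft) σ-ok = substT-FVBelow σ s fs σ-ok , substT-FVBelow σ t ft σ-ok

liftS-FVBelow : ∀ {k k'} (σ : Subst) → (∀ i → i < k → FVBelowᵗ k' (σ i)) →
                ∀ i → i < suc k → FVBelowᵗ (suc k') (liftS σ i)
liftS-FVBelow σ σ-ok zero _ = s≤s z≤n
liftS-FVBelow σ σ-ok (suc i) (s≤s i<k) = substT-FVBelow _ (σ i) (σ-ok i i<k) (λ j j<k' → s≤s j<k')

substF-FVBelow : ∀ {k k'} (σ : Subst) φ → FVBelow k φ → (∀ i → i < k → FVBelowᵗ k' (σ i)) →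
                 FVBelow k' (substF σ φ)
substF-FVBelow σ (s `= t) (fs , ft) σ-ok = substT-FVBelow σ s fs σ-ok , substT-FVBelow σ t ft σ-ok
substF-FVBelow σ (s `< t) (fs , ft) σ-ok = substT-FVBelow σ s fs σ-ok , substT-FVBelow σ t ft σ-ok
substF-FVBelow σ `⊥ _ σ-ok = tt
substF-FVBelow σ (φ `∧ ψ) (fφ , fψ) σ-ok = substF-FVBelow σ φ fφ σ-ok , substF-FVBelow σ ψ fψ σ-ok
substF-FVBelow σ (φ `∨ ψ) (fφ , fψ) σ-ok = substF-FVBelow σ φ fφ σ-ok , substF-FVBelow σ ψ fψ σ-ok
substF-FVBelow σ (φ `→ ψ) (fφ , fψ) σ-ok = substF-FVBelow σ φ fφ σ-ok , substF-FVBelow σ ψ fψ σ-ok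
substF-FVBelow σ (`∀ φ) fφ σ-ok = substF-FVBelow (liftS σ) φ fφ (liftS-FVBelow σ σ-ok)
substF-FVBelow σ (`∃ φ) fφ σ-ok = substF-FVBelow (liftS σ) φ fφ (liftS-FVBelow σ σ-ok)

module _ (Q : ℕ → Set) where

  substT-AllConsts : ∀ {k} (σ : Subst) t → AllConstsᵗ Q t → FVBelowᵗ k t →
                     (∀ i → i < k → AllConstsᵗ Q (σ i)) → AllConstsᵗ Q (substT σ t)
  substT-AllConsts σ (var n) _ n<k σ-ok = σ-ok n n<k
  substT-AllConsts σ (con j) qj _ σ-ok = qj
  substT-AllConsts σ `0 _ _ σ-ok = tt
  substT-AllConsts σ `1 _ _ σ-ok = tt
  substT-AllConsts σ (s `+ t) (qs , qt) (fs , ft) σ-ok = substT-AllConsts σ s qs fs σ-ok , substT-AllConsts σ t qt ft σ-ok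
  substT-AllConsts σ (s `* t) (qs , qt) (fs , ft) σ-ok = substT-AllConsts σ s qs fs σ-ok , substT-AllConsts σ t qt ft σ-ok

  shift-AllConsts : ∀ t → AllConstsᵗ Q t → AllConstsᵗ Q (substT (λ i → var (suc i)) t)
  shift-AllConsts (var n) _ = tt
  shift-AllConsts (con j) qj = qj
  shift-AllConsts `0 _ = tt
  shift-AllConsts `1 _ = tt
  shift-AllConsts (s `+ t) (qs , qt) = shift-AllConsts s qs , shift-AllConsts t qt
  shift-AllConsts (s `* t) (qs , qt) = shift-AllConsts s qs , shift-AllConsts t qt

  liftS-AllConsts : ∀ {k} (σ : Subst) → (∀ i → i < k → AllConstsᵗ Q (σ i)) →
                    ∀ i → i < suc k → AllConstsᵗ Q (liftS σ i)
  liftS-AllConsts σ σ-ok zero _ = tt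
  liftS-AllConsts σ σ-ok (suc i) (s≤s i<k) = shift-AllConsts (σ i) (σ-ok i i<k)

  substF-AllConsts : ∀ {k} (σ : Subst) φ → AllConsts Q φ → FVBelow k φ →
                     (∀ i → i < k → AllConstsᵗ Q (σ i)) → AllConsts Q (substF σ φ)
  substF-AllConsts σ (s `= t) (qs , qt) (fs , ft) σ-ok = substT-AllConsts σ s qs fs σ-ok , substT-AllConsts σ t qt ft σ-ok
  substF-AllConsts σ (s `< t) (qs , qt) (fs , ft) σ-ok = substT-AllConsts σ s qs fs σ-ok , substT-AllConsts σ t qt ft σ-ok
  substF-AllConsts σ `⊥ _ _ σ-ok = tt
  substF-AllConsts σ (φ `∧ ψ) (qφ , qψ) (fφ , fψ) σ-ok = substF-AllConsts σ φ qφ fφ σ-ok , substF-AllConsts σ ψ qψ fψ σ-ok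
  substF-AllConsts σ (φ `∨ ψ) (qφ , qψ) (fφ , fψ) σ-ok = substF-AllConsts σ φ qφ fφ σ-ok , substF-AllConsts σ ψ qψ fψ σ-ok
  substF-AllConsts σ (φ `→ ψ) (qφ , qψ) (fφ , fψ) σ-ok = substF-AllConsts σ φ qφ fφ σ-ok , substF-AllConsts σ ψ qψ fψ σ-ok
  substF-AllConsts σ (`∀ φ) qφ fφ σ-ok = substF-AllConsts (liftS σ) φ qφ fφ (liftS-AllConsts σ σ-ok)
  substF-AllConsts σ (`∃ φ) qφ fφ σ-ok = substF-AllConsts (liftS σ) φ qφ fφ (liftS-AllConsts σ σ-ok)

-- instantiate k φ v says φ(c_{v 0}, …, c_{v (k-1)}) through equations ∃x (x = c_{v i} ∧ …)
-- rather than substitution, so that its code is obtained from ⌜ φ ⌝ by pairing alone.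
instantiate : ℕ → Formula → (ℕ → ℕ) → Formula
instantiate zero φ v = φ
instantiate (suc k) φ v = instantiate k (`∃ (var 0 `= con (v 0) `∧ φ)) (λ i → v (suc i))

bindCode : ℕ → ℕ → ℕ
bindCode a c = pair 7 (pair 3 (pair ⌜ var 0 `= con a ⌝ c))

instantiateCode : ℕ → ℕ → (ℕ → ℕ) → ℕ
instantiateCode zero c v = c
instantiateCode (suc k) c v = instantiateCode k (bindCode (v 0) c) (λ i → v (suc i))

⌜instantiate⌝ : ∀ k φ v → ⌜ instantiate k φ v ⌝ ≡ instantiateCode k ⌜ φ ⌝ v
⌜instantiate⌝ zero φ v = refl
⌜instantiate⌝ (suc k) φ v = ⌜instantiate⌝ k _ (λ i → v (suc i))

instantiate-Sentence : ∀ k φ v → FVBelow k φ → Sentence (instantiate k φ v)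
instantiate-Sentence zero φ v fv = fv
instantiate-Sentence (suc k) φ v fv = instantiate-Sentence k _ (λ i → v (suc i)) ((s≤s z≤n , tt) , fv)

instantiate-AllConsts : ∀ (Q : ℕ → Set) k φ v → AllConsts Q φ → (∀ i → Q (v i)) → AllConsts Q (instantiate k φ v)
instantiate-AllConsts Q zero φ v qφ qv = qφ
instantiate-AllConsts Q (suc k) φ v qφ qv =
  instantiate-AllConsts Q k _ (λ i → v (suc i)) ((tt , qv 0) , qφ) (λ i → qv (suc i))

∃^ : ℕ → Formula → Formula
∃^ zero φ = φ
∃^ (suc r) φ = `∃ (∃^ r φ)

∃^Code : ℕ → ℕ → ℕ
∃^Code zero c = c
∃^Code (suc r) c = pair 7 (∃^Code r c)

⌜∃^⌝ : ∀ r φ → ⌜ ∃^ r φ ⌝ ≡ ∃^Code r ⌜ φ ⌝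
⌜∃^⌝ zero φ = refl
⌜∃^⌝ (suc r) φ = cong (pair 7) (⌜∃^⌝ r φ)

FVBelow-+-suc : ∀ r {k} φ → FVBelow (suc r + k) φ → FVBelow (r + suc k) φ
FVBelow-+-suc r {k} φ = subst (λ x → FVBelow x φ) (sym (+-suc r k))

∃^-FVBelow : ∀ r {k} φ → FVBelow (r + k) φ → FVBelow k (∃^ r φ)
∃^-FVBelow zero φ fv = fv
∃^-FVBelow (suc r) φ fv = ∃^-FVBelow r φ (FVBelow-+-suc r φ fv)

∃^-ConstFree : ∀ r φ → ConstFree φ → ConstFree (∃^ r φ)
∃^-ConstFree zero φ cf = cf
∃^-ConstFree (suc r) φ cf = ∃^-ConstFree r φ cf

module _ {B : Subset} where

  bindCode-computable : ∀ {k} {a c : Vec ℕ k → ℕ} → Computable B k a → Computable B k c →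
                        Computable B k (λ xs → bindCode (a xs) (c xs))
  bindCode-computable ca cc =
    pair∘ (const-computable 7) (pair∘ (const-computable 3) (pair∘
      (pair∘ (const-computable 0) (pair∘ (const-computable (pair 0 0)) (pair∘ (const-computable 1) ca))) cc))
    where
    pair∘ : ∀ {k} {f g : Vec ℕ k → ℕ} → Computable B k f → Computable B k g → Computable B k (λ xs → pair (f xs) (g xs))
    pair∘ = ∘-computable₂ pair pair-computable

  instantiateCode-computable : ∀ {k} n {c : Vec ℕ k → ℕ} {v : ℕ → Vec ℕ k → ℕ} → Computable B k c →
                               (∀ i → Computable B k (v i)) → Computable B k (λ xs → instantiateCode n (c xs) (λ i → v i xs))
  instantiateCode-computable zero cc cv = cc
  instantiateCode-computable (suc n) cc cv = instantiateCode-computable n (bindCode-computable (cv 0) cc) (λ i → cv (suc i))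

  ∃^Code-computable : ∀ {k} r {c : Vec ℕ k → ℕ} → Computable B k c → Computable B k (λ xs → ∃^Code r (c xs))
  ∃^Code-computable zero cc = cc
  ∃^Code-computable (suc r) cc = ∘-computable₂ pair pair-computable (const-computable 7) (∃^Code-computable r cc)

∃^-intro : ∀ {Ax} r φ → Deriv Ax [] (substF con φ) → Deriv Ax [] (substF (λ i → con (r + i)) (∃^ r φ))
∃^-intro zero φ d = d
∃^-intro {Ax} (suc r) φ d =
  ∃I (con r) (subst (Deriv Ax []) (sym (trans (substF-liftS-[] _ (con r) (∃^ r φ)) (substF-cong shift (∃^ r φ))))
               (∃^-intro r φ d))
  where
  shift : ∀ i → (con r ∷ₛ (λ i → con (suc r + i))) i ≡ con (r + i)
  shift zero = cong con (sym (+-identityʳ r))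
  shift (suc i) = cong con (sym (+-suc r i))

module Semantics (S : PreStructure) where
  open PreStructure S

  private
    ∀-⇔ : {P Q : A → Set} → (∀ a → P a ⇔ Q a) → ((a : A) → Dom a → P a) ⇔ ((a : A) → Dom a → Q a)
    ∀-⇔ P⇔Q = mk⇔ (λ h a da → P⇔Q a .to (h a da)) (λ h a da → P⇔Q a .from (h a da))

    ∷ₑ-agree : ∀ a {k} {ρ ρ' : ℕ → A} → (∀ i → i < k → ρ i ≡ ρ' i) → ∀ i → i < suc k → _∷ₑ_ S a ρ i ≡ _∷ₑ_ S a ρ' i
    ∷ₑ-agree a agree zero _ = refl
    ∷ₑ-agree a agree (suc i) (s≤s i<k) = agree i i<k

    ∷ₑ-cong : ∀ a {ρ ρ' : ℕ → A} → (∀ i → ρ i ≡ ρ' i) → ∀ i → _∷ₑ_ S a ρ i ≡ _∷ₑ_ S a ρ' i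
    ∷ₑ-cong a ρ≗ρ' zero = refl
    ∷ₑ-cong a ρ≗ρ' (suc i) = ρ≗ρ' i

    ∃-⇔ : {P Q : A → Set} → (∀ a → P a ⇔ Q a) → (Σ A λ a → Dom a × P a) ⇔ (Σ A λ a → Dom a × Q a)
    ∃-⇔ P⇔Q = mk⇔ (λ (a , da , p) → a , da , P⇔Q a .to p) (λ (a , da , q) → a , da , P⇔Q a .from q)

  evalT-cong-FVBelow : ∀ κ {k} {ρ ρ' : ℕ → A} t → FVBelowᵗ k t → (∀ i → i < k → ρ i ≡ ρ' i) →
                       evalT S κ ρ t ≡ evalT S κ ρ' t
  evalT-cong-FVBelow κ (var n) n<k agree = agree n n<k
  evalT-cong-FVBelow κ (con j) _ agree = refl
  evalT-cong-FVBelow κ `0 _ agree = refl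
  evalT-cong-FVBelow κ `1 _ agree = refl
  evalT-cong-FVBelow κ (s `+ t) (fs , ft) agree = cong₂ add (evalT-cong-FVBelow κ s fs agree) (evalT-cong-FVBelow κ t ft agree)
  evalT-cong-FVBelow κ (s `* t) (fs , ft) agree = cong₂ mul (evalT-cong-FVBelow κ s fs agree) (evalT-cong-FVBelow κ t ft agree)

  Sat-cong-FVBelow : ∀ κ {k} {ρ ρ' : ℕ → A} φ → FVBelow k φ → (∀ i → i < k → ρ i ≡ ρ' i) →
                     Sat S κ ρ φ ⇔ Sat S κ ρ' φ
  Sat-cong-FVBelow κ (s `= t) (fs , ft) agree
    rewrite evalT-cong-FVBelow κ s fs agree | evalT-cong-FVBelow κ t ft agree = ⇔-id _
  Sat-cong-FVBelow κ (s `< t) (fs , ft) agree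
    rewrite evalT-cong-FVBelow κ s fs agree | evalT-cong-FVBelow κ t ft agree = ⇔-id _
  Sat-cong-FVBelow κ `⊥ _ agree = ⇔-id _
  Sat-cong-FVBelow κ (φ `∧ ψ) (fφ , fψ) agree = Sat-cong-FVBelow κ φ fφ agree ×-⇔ Sat-cong-FVBelow κ ψ fψ agree
  Sat-cong-FVBelow κ (φ `∨ ψ) (fφ , fψ) agree = Sat-cong-FVBelow κ φ fφ agree ⊎-⇔ Sat-cong-FVBelow κ ψ fψ agree
  Sat-cong-FVBelow κ (φ `→ ψ) (fφ , fψ) agree = →-cong-⇔ (Sat-cong-FVBelow κ φ fφ agree) (Sat-cong-FVBelow κ ψ fψ agree)
  Sat-cong-FVBelow κ (`∀ φ) fφ agree = ∀-⇔ λ a → Sat-cong-FVBelow κ φ fφ (∷ₑ-agree a agree)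
  Sat-cong-FVBelow κ (`∃ φ) fφ agree = ∃-⇔ λ a → Sat-cong-FVBelow κ φ fφ (∷ₑ-agree a agree)

  evalT-cong : ∀ κ {ρ ρ' : ℕ → A} t → (∀ i → ρ i ≡ ρ' i) → evalT S κ ρ t ≡ evalT S κ ρ' t
  evalT-cong κ (var n) ρ≗ρ' = ρ≗ρ' n
  evalT-cong κ (con j) ρ≗ρ' = refl
  evalT-cong κ `0 ρ≗ρ' = refl
  evalT-cong κ `1 ρ≗ρ' = refl
  evalT-cong κ (s `+ t) ρ≗ρ' = cong₂ add (evalT-cong κ s ρ≗ρ') (evalT-cong κ t ρ≗ρ')
  evalT-cong κ (s `* t) ρ≗ρ' = cong₂ mul (evalT-cong κ s ρ≗ρ') (evalT-cong κ t ρ≗ρ')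

  Sat-cong : ∀ κ {ρ ρ' : ℕ → A} φ → (∀ i → ρ i ≡ ρ' i) → Sat S κ ρ φ ⇔ Sat S κ ρ' φ
  Sat-cong κ (s `= t) ρ≗ρ' rewrite evalT-cong κ s ρ≗ρ' | evalT-cong κ t ρ≗ρ' = ⇔-id _
  Sat-cong κ (s `< t) ρ≗ρ' rewrite evalT-cong κ s ρ≗ρ' | evalT-cong κ t ρ≗ρ' = ⇔-id _
  Sat-cong κ `⊥ ρ≗ρ' = ⇔-id _
  Sat-cong κ (φ `∧ ψ) ρ≗ρ' = Sat-cong κ φ ρ≗ρ' ×-⇔ Sat-cong κ ψ ρ≗ρ'
  Sat-cong κ (φ `∨ ψ) ρ≗ρ' = Sat-cong κ φ ρ≗ρ' ⊎-⇔ Sat-cong κ ψ ρ≗ρ'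
  Sat-cong κ (φ `→ ψ) ρ≗ρ' = →-cong-⇔ (Sat-cong κ φ ρ≗ρ') (Sat-cong κ ψ ρ≗ρ')
  Sat-cong κ (`∀ φ) ρ≗ρ' = ∀-⇔ λ a → Sat-cong κ φ (∷ₑ-cong a ρ≗ρ')
  Sat-cong κ (`∃ φ) ρ≗ρ' = ∃-⇔ λ a → Sat-cong κ φ (∷ₑ-cong a ρ≗ρ')

  evalT-substT : ∀ κ (ρ : ℕ → A) σ t → evalT S κ ρ (substT σ t) ≡ evalT S κ (λ i → evalT S κ ρ (σ i)) t
  evalT-substT κ ρ σ (var n) = refl
  evalT-substT κ ρ σ (con j) = refl
  evalT-substT κ ρ σ `0 = refl
  evalT-substT κ ρ σ `1 = refl
  evalT-substT κ ρ σ (s `+ t) = cong₂ add (evalT-substT κ ρ σ s) (evalT-substT κ ρ σ t)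
  evalT-substT κ ρ σ (s `* t) = cong₂ mul (evalT-substT κ ρ σ s) (evalT-substT κ ρ σ t)

  evalT-liftS : ∀ κ (ρ : ℕ → A) σ a i → evalT S κ (_∷ₑ_ S a ρ) (liftS σ i) ≡ _∷ₑ_ S a (λ j → evalT S κ ρ (σ j)) i
  evalT-liftS κ ρ σ a zero = refl
  evalT-liftS κ ρ σ a (suc i) = evalT-substT κ (_∷ₑ_ S a ρ) (λ j → var (suc j)) (σ i)

  Sat-substF : ∀ κ (ρ : ℕ → A) σ φ → Sat S κ ρ (substF σ φ) ⇔ Sat S κ (λ i → evalT S κ ρ (σ i)) φ
  Sat-substF κ ρ σ (s `= t) rewrite evalT-substT κ ρ σ s | evalT-substT κ ρ σ t = ⇔-id _
  Sat-substF κ ρ σ (s `< t) rewrite evalT-substT κ ρ σ s | evalT-substT κ ρ σ t = ⇔-id _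
  Sat-substF κ ρ σ `⊥ = ⇔-id _
  Sat-substF κ ρ σ (φ `∧ ψ) = Sat-substF κ ρ σ φ ×-⇔ Sat-substF κ ρ σ ψ
  Sat-substF κ ρ σ (φ `∨ ψ) = Sat-substF κ ρ σ φ ⊎-⇔ Sat-substF κ ρ σ ψ
  Sat-substF κ ρ σ (φ `→ ψ) = →-cong-⇔ (Sat-substF κ ρ σ φ) (Sat-substF κ ρ σ ψ)
  Sat-substF κ ρ σ (`∀ φ) = ∀-⇔ λ a → Sat-cong κ φ (evalT-liftS κ ρ σ a) ⇔-∘ Sat-substF κ _ (liftS σ) φ
  Sat-substF κ ρ σ (`∃ φ) = ∃-⇔ λ a → Sat-cong κ φ (evalT-liftS κ ρ σ a) ⇔-∘ Sat-substF κ _ (liftS σ) φ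

module InstantiateSemantics (M : ωStructure) where
  open ωStructure M
  open Semantics (asPre M)

  instantiate-Sat : ∀ k φ (v ρ : ℕ → ℕ) → FVBelow k φ → (∀ i → dom (v i) ≡ true) →
                    Sat (asPre M) (λ j → j) ρ (instantiate k φ v) ⇔ Sat (asPre M) (λ j → j) v φ
  instantiate-Sat zero φ v ρ fv _ = Sat-cong-FVBelow _ φ fv (λ _ ())
  instantiate-Sat (suc k) φ v ρ fv v∈ =
    mk⇔ (λ { (_ , _ , refl , sφ) → Sat-cong _ φ v₀∷v' .to sφ }) (λ sφ → v 0 , v∈ 0 , refl , Sat-cong _ φ v₀∷v' .from sφ)
      ⇔-∘ instantiate-Sat k _ (λ i → v (suc i)) ρ ((s≤s z≤n , tt) , fv) (λ i → v∈ (suc i))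
    where
    v₀∷v' : ∀ i → _∷ₑ_ (asPre M) (v 0) (λ j → v (suc j)) i ≡ v i
    v₀∷v' zero = refl
    v₀∷v' (suc i) = refl

module ScottSetClosure {X : Subset → Set} (SS : ScottSet X) where
  open ScottSet SS

  X-computable : ∀ {A B} → X B → ComputableSet B A → X A
  X-computable xB cA = turing xB (computableSet⇒≤T cA)

  X-⊕ : ∀ {A C} → X A → X C → X (A ⊕ C)
  X-⊕ {A} {C} xA xC = union {λ n → isEven n ∧ A (half n)} {λ n → not (isEven n) ∧ C (half n)} (X-computable xA (∧-computable even (∈-computable A oracle-computable half-x₀)))
                            (X-computable xC (∧-computable (not-computable even) (∈-computable C oracle-computable half-x₀)))
    where
    even : ∀ {B} → ComputablePred B 1 (λ xs → isEven (head xs))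
    even = ∈-computable isEven isEven-computable x₀
    half-x₀ : ∀ {B} → Computable₁ B half
    half-x₀ = ∘-computable₁ half half-computable x₀

module UltrafilterLaws {X : Subset → Set} (SS : ScottSet X) {U : Subset → Set} (UF : NonPrincipalUltrafilter X U) where
  open ScottSet SS
  open NonPrincipalUltrafilter UF
  open ScottSetClosure SS

  U-cong : ∀ {A C} → (∀ n → A n ≡ C n) → U A → U C
  U-cong {A} {C} A≗C uA = upward uA (X-computable (inX uA) (computable-ext (λ { (n ∷ []) → cong bit (A≗C n) }) oracle-computable))
                                 (λ n An → trans (sym (A≗C n)) An)

  U-cong-⇔ : ∀ {A C} → (∀ n → A n ≡ C n) → U A ⇔ U C
  U-cong-⇔ A≗C = mk⇔ (U-cong A≗C) (U-cong (sym ∘ A≗C))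

  U-nonempty : ∀ {A} → U A → ¬ (∀ n → A n ≡ false)
  U-nonempty uA A≗∅ = empty∉ (U-cong A≗∅ uA)

  U-∧ : ∀ {A C} → X A → X C → U (λ n → A n ∧ C n) ⇔ (U A × U C)
  U-∧ {A} {C} xA xC = mk⇔
    (λ u → upward u xA (λ n → proj₁ ∘ both n) , upward u xC (λ n → proj₂ ∘ both n))
    (λ (uA , uC) → inter uA uC)
    where
    both : ∀ n → (A n ∧ C n) ≡ true → A n ≡ true × C n ≡ true
    both n = reflects-true⇒ (≡true-reflects (A n) ×-reflects ≡true-reflects (C n))

  U-∨ : ∀ {A C} → X A → X C → U (λ n → A n ∨ C n) ⇔ (U A ⊎ U C)
  U-∨ {A} {C} xA xC = mk⇔
    (λ u → either inj₁ (λ u¬A → inj₂ (upward (inter u¬A u) xC (λ n → right n))) (ultra xA))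
    (either (λ uA → upward uA xA∨C (λ n An → reflects-⇒true (disjunction n) (inj₁ An)))
            (λ uC → upward uC xA∨C (λ n Cn → reflects-⇒true (disjunction n) (inj₂ Cn))))
    where
    xA∨C : X (λ n → A n ∨ C n)
    xA∨C = union xA xC
    disjunction : ∀ n → Reflects (A n ≡ true ⊎ C n ≡ true) (A n ∨ C n)
    disjunction n = ≡true-reflects (A n) ⊎-reflects ≡true-reflects (C n)
    right : ∀ n → (not (A n) ∧ (A n ∨ C n)) ≡ true → C n ≡ true
    right n e with reflects-true⇒ (¬-reflects (≡true-reflects (A n)) ×-reflects disjunction n) e
    ... | ¬An , inj₁ An = ⊥-elim (¬An An)
    ... | _ , inj₂ Cn = Cn

  U-⇒ : ∀ {A C} → X A → X C → U (λ n → not (A n) ∨ C n) ⇔ (U A → U C)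
  U-⇒ {A} {C} xA xC = mk⇔
    (λ u uA → upward (inter u uA) xC (λ n → modus-ponens n))
    (λ h → either (λ uA → upward (h uA) xA⇒C (λ n Cn → reflects-⇒true (implies n) (λ _ → Cn)))
                  (λ u¬A → upward u¬A xA⇒C (λ n ¬An → reflects-⇒true (implies n) (λ An → contradict n An ¬An)))
                  (ultra xA))
    where
    xA⇒C : X (λ n → not (A n) ∨ C n)
    xA⇒C = union (complement xA) xC
    implies : ∀ n → Reflects (A n ≡ true → C n ≡ true) (not (A n) ∨ C n)
    implies n = ≡true-reflects (A n) →-reflects ≡true-reflects (C n)
    modus-ponens : ∀ n → ((not (A n) ∨ C n) ∧ A n) ≡ true → C n ≡ true
    modus-ponens n e = let (A⇒C , An) = reflects-true⇒ (implies n ×-reflects ≡true-reflects (A n)) e in A⇒C An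
    contradict : ∀ n → A n ≡ true → not (A n) ≡ true → C n ≡ true
    contradict n An ¬An = ⊥-elim (reflects-true⇒ (¬-reflects (≡true-reflects (A n))) ¬An An)

  -- the set {t | j ≤ t}, written so that it is evidently computable
  atLeast : ℕ → Subset
  atLeast j t = (j ∸ t) ≡ᵇ 0

  atLeast-≤ : ∀ j t → atLeast j t ≡ true → j ≤ t
  atLeast-≤ j t e = m∸n≡0⇒m≤n (reflects-true⇒ (≡ᵇ-reflects (j ∸ t) 0) e)

  U-atLeast : ∀ j → U (atLeast j)
  U-atLeast j = either (λ u → u) (λ u → ⊥-elim (nonprincipal u (j , below))) (ultra x-atLeast)
    where
    x-atLeast : X (atLeast j)
    x-atLeast = X-computable (proj₂ nonempty)
                  (≡ᵇ-computable (∘-computable₂ _∸_ ∸-computable (const-computable j) x₀) (const-computable 0))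
    below : ∀ t → not (atLeast j t) ≡ true → t < j
    below t e = ≰⇒> λ j≤t → reflects-true⇒ (¬-reflects (≡ᵇ-reflects (j ∸ t) 0)) e (m≤n⇒m∸n≡0 j≤t)

-- Łoś's theorem for ∏_X M / U

module Diagram {X : Subset → Set} (SS : ScottSet X) (M : ωStructure) (coded : CodedIn X M) where
  open ωStructure M
  open InstantiateSemantics M

  SatM : (ℕ → ℕ) → Formula → Set
  SatM v φ = Sat (asPre M) (λ j → j) v φ

  D : Subset
  D = proj₁ (proj₂ coded)

  X-D : X D
  X-D = proj₁ (proj₂ (proj₂ coded))

  X-dom : X dom
  X-dom = proj₁ coded

  D-reflects-sentence : ∀ σ → Sentence σ → AllConsts (λ a → dom a ≡ true) σ → Reflects (SatM (λ _ → z) σ) (D ⌜ σ ⌝)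
  D-reflects-sentence σ sentence consts = ⇔-reflects (mk⇔ sound (proj₂ (proj₂ (proj₂ (proj₂ coded))) σ sentence consts))
    where
    sound : D ⌜ σ ⌝ ≡ true → SatM (λ _ → z) σ
    sound e with proj₁ (proj₂ (proj₂ (proj₂ coded))) ⌜ σ ⌝ e
    ... | φ , ⌜φ⌝≡⌜σ⌝ , _ , _ , sat with ⌜⌝-injective φ σ ⌜φ⌝≡⌜σ⌝
    ... | refl = sat

  D-reflects : ∀ k φ v → ConstFree φ → FVBelow k φ → (∀ i → dom (v i) ≡ true) →
               Reflects (SatM v φ) (D (instantiateCode k ⌜ φ ⌝ v))
  D-reflects k φ v cf fv v∈ rewrite sym (⌜instantiate⌝ k φ v) =
    reflects-⇔ (instantiate-Sat k φ v (λ _ → z) fv v∈)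
      (D-reflects-sentence (instantiate k φ v) (instantiate-Sentence k φ v fv)
        (instantiate-AllConsts _ k φ v (ConstFree⇒AllConsts _ φ cf) v∈))

  SatM? : ∀ k φ v → ConstFree φ → FVBelow k φ → (∀ i → dom (v i) ≡ true) → Dec (SatM v φ)
  SatM? k φ v cf fv v∈ = _ because D-reflects k φ v cf fv v∈

  -- Satisfaction in M is decided by the diagram, so M obeys classical logic.
  ¬∃¬⇒∀ : ∀ {k} φ v → ConstFree φ → FVBelow (suc k) φ → (∀ i → dom (v i) ≡ true) →
          ¬ SatM v (`∃ (`¬ φ)) → SatM v (`∀ φ)
  ¬∃¬⇒∀ {k} φ v cf fv v∈ no-counterexample a a∈ with SatM? (suc k) φ (_∷ₑ_ (asPre M) a v) cf fv a∷v∈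
    where
    a∷v∈ : ∀ i → dom (_∷ₑ_ (asPre M) a v i) ≡ true
    a∷v∈ zero = a∈
    a∷v∈ (suc i) = v∈ i
  ... | yes sat = sat
  ... | no ¬sat = ⊥-elim (no-counterexample (a , a∈ , ¬sat))

module Łoś {X : Subset → Set} (SS : ScottSet X) (M : ωStructure) (coded : CodedIn X M)
           {U : Subset → Set} (UF : NonPrincipalUltrafilter X U) where
  open ωStructure M
  open NonPrincipalUltrafilter UF
  open ScottSetClosure SS
  open UltrafilterLaws SS UF
  open Diagram SS M coded public
  open Semantics (asPre M) using (Sat-cong)

  K : PreStructure
  K = UltraProduct X U M

  _at_ : (ℕ → ℕ → ℕ) → ℕ → ℕ → ℕ
  (ρ at n) i = ρ i n

  infixr 5 _∷ᴷ_
  _∷ᴷ_ : (ℕ → ℕ) → (ℕ → ℕ → ℕ) → ℕ → ℕ → ℕ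
  _∷ᴷ_ = _∷ₑ_ K

  record ComputesDiagram (B : Subset) : Set where
    field
      X-oracle : X B
      D-computable : ComputableSet B D
      dom-computable : ComputableSet B dom

  ComputableEnv : Subset → (ℕ → ℕ → ℕ) → Set
  ComputableEnv B ρ = ∀ i → Computable₁ B (ρ i)

  ProductEnv : (ℕ → ℕ → ℕ) → Set
  ProductEnv ρ = ∀ i → InProd X M (ρ i)

  truthSet : ℕ → Formula → (ℕ → ℕ → ℕ) → Subset
  truthSet k φ ρ n = D (instantiateCode k ⌜ φ ⌝ (ρ at n))

  truthSet-reflects : ∀ k φ ρ → ConstFree φ → FVBelow k φ → ProductEnv ρ → ∀ n →
                      Reflects (SatM (ρ at n) φ) (truthSet k φ ρ n)
  truthSet-reflects k φ ρ cf fv ρ∈ n = D-reflects k φ (ρ at n) cf fv (λ i → proj₁ (ρ∈ i) n)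

  ∷ᴷ-ProductEnv : ∀ {f ρ} → InProd X M f → ProductEnv ρ → ProductEnv (f ∷ᴷ ρ)
  ∷ᴷ-ProductEnv f∈ ρ∈ zero = f∈
  ∷ᴷ-ProductEnv f∈ ρ∈ (suc i) = ρ∈ i

  ∷ᴷ-ComputableEnv : ∀ {B f ρ} → Computable₁ B f → ComputableEnv B ρ → ComputableEnv B (f ∷ᴷ ρ)
  ∷ᴷ-ComputableEnv cf cρ zero = cf
  ∷ᴷ-ComputableEnv cf cρ (suc i) = cρ i

  ⊕graph-ComputesDiagram : ∀ {B f} → ComputesDiagram B → InProd X M f → ComputesDiagram (B ⊕ graph f)
  ⊕graph-ComputesDiagram {B} {f} Bd (_ , X-graph) = record
    { X-oracle = X-⊕ X-oracle X-graph
    ; D-computable = computable-trans (⊕-computableˡ B (graph f)) D-computable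
    ; dom-computable = computable-trans (⊕-computableˡ B (graph f)) dom-computable
    }
    where open ComputesDiagram Bd

  ⊕graph-ComputableEnv : ∀ {B f ρ} → ComputableEnv B ρ → ComputableEnv (B ⊕ graph f) (f ∷ᴷ ρ)
  ⊕graph-ComputableEnv {B} {f} cρ = ∷ᴷ-ComputableEnv (computable-trans (⊕-computableʳ B (graph f)) graph-decodable)
                                                      (λ i → computable-trans (⊕-computableˡ B (graph f)) (cρ i))

  module _ {B : Subset} (Bd : ComputesDiagram B) where
    open ComputesDiagram Bd

    X-computableFrom : ∀ {A} → ComputableSet B A → X A
    X-computableFrom = X-computable X-oracle

    computable-InProd : ∀ {f} → Computable₁ B f → (∀ n → dom (f n) ≡ true) → InProd X M f
    computable-InProd cf f∈ = f∈ , X-computableFrom (graph-computable cf)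

    instantiated-computable : ∀ {j} k {c : Vec ℕ j → ℕ} {v : ℕ → Vec ℕ j → ℕ} → Computable B j c → (∀ i → Computable B j (v i)) →
                              ComputablePred B j (λ xs → D (instantiateCode k (c xs) (λ i → v i xs)))
    instantiated-computable k cc cv = ∈-computable D D-computable (instantiateCode-computable k cc cv)

    truthSet-computable : ∀ k φ ρ → ComputableEnv B ρ → ComputableSet B (truthSet k φ ρ)
    truthSet-computable k φ ρ cρ = instantiated-computable k (const-computable ⌜ φ ⌝) (λ i → ∘-computable₁ (ρ i) (cρ i) x₀)

    X-truthSet : ∀ k φ ρ → ComputableEnv B ρ → X (truthSet k φ ρ)
    X-truthSet k φ ρ cρ = X-computableFrom (truthSet-computable k φ ρ cρ)

    -- w t is the least c ∈ M with φ_t(c, E_t) whenever M ⊨ ∃x φ_t(x, E_t); the diagram decides that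
    -- hypothesis, and when it holds any witness bounds the search.
    skolem : ∀ {L} (φ : ℕ → Formula) → (∀ t → ConstFree (φ t)) → (∀ t → FVBelow (suc L) (φ t)) →
             Computable₁ B (λ t → ⌜ φ t ⌝) → ∀ E → ComputableEnv B E → ProductEnv E →
             Σ (ℕ → ℕ) λ w → Computable₁ B w × InProd X M w ×
               (∀ t → SatM (E at t) (`∃ (φ t)) → SatM ((w ∷ᴷ E) at t) (φ t))
    skolem {L} φ cf fv cφ E cE E∈ = w , cw , w∈ , w-witness
      where
      ∃-holds : ℕ → Bool
      ∃-holds t = D (instantiateCode L ⌜ `∃ (φ t) ⌝ (E at t))
      ∃-reflects : ∀ t → Reflects (SatM (E at t) (`∃ (φ t))) (∃-holds t)
      ∃-reflects t = D-reflects L (`∃ (φ t)) (E at t) (cf t) (fv t) (λ i → proj₁ (E∈ i) t)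
      φ-holds : ℕ → ℕ → Bool
      φ-holds c t = D (instantiateCode L (bindCode c ⌜ φ t ⌝) (E at t))
      good : ℕ → ℕ → Bool
      good c t = dom c ∧ (not (∃-holds t) ∨ φ-holds c t)
      bound : ∀ t → Σ ℕ λ c → good c t ≡ true
      bound t with ∃-holds t | ∃-reflects t
      ... | false | _ = z , cong (_∧ true) z∈
      ... | true | ofʸ (a , a∈ , sat) =
        a , cong₂ _∧_ a∈ (reflects-⇒true (D-reflects (suc L) (φ t) (_∷ₑ_ (asPre M) a (E at t)) (cf t) (fv t) a∷E∈) sat)
        where
        a∷E∈ : ∀ i → dom (_∷ₑ_ (asPre M) a (E at t) i) ≡ true
        a∷E∈ zero = a∈
        a∷E∈ (suc i) = proj₁ (E∈ i) t
      w : ℕ → ℕ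
      w t = search (λ c → good c t) (proj₁ (bound t))
      w-ok : ∀ t → dom (w t) ≡ true × (not (∃-holds t) ∨ φ-holds (w t) t) ≡ true
      w-ok t = reflects-true⇒ (≡true-reflects _ ×-reflects ≡true-reflects _)
                 (search-sound (λ c → good c t) (proj₁ (bound t)) (proj₂ (bound t)))
      cw : Computable₁ B w
      cw = search-computable good
             (∧-computable (∈-computable dom dom-computable x₀)
               (∨-computable (not-computable (instantiated-computable L (∃^Code-computable 1 φ-code) E-at))
                             (instantiated-computable L (bindCode-computable x₀ φ-code) E-at)))
             (proj₁ ∘ bound) (proj₂ ∘ bound)
        where
        φ-code : Computable B 2 (λ xs → ⌜ φ (head (tail xs)) ⌝)
        φ-code = ∘-computable₁ (λ t → ⌜ φ t ⌝) cφ x₁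
        E-at : ∀ i → Computable B 2 (λ xs → E i (head (tail xs)))
        E-at i = ∘-computable₁ (E i) (cE i) x₁
      w∈ : InProd X M w
      w∈ = computable-InProd cw (λ t → proj₁ (w-ok t))
      w-witness : ∀ t → SatM (E at t) (`∃ (φ t)) → SatM ((w ∷ᴷ E) at t) (φ t)
      w-witness t sat∃ =
        reflects-true⇒ (D-reflects (suc L) (φ t) ((w ∷ᴷ E) at t) (cf t) (fv t) (λ i → proj₁ (∷ᴷ-ProductEnv w∈ E∈ i) t))
          (reflects-true⇒ (∃-reflects t →-reflects ≡true-reflects _) (proj₂ (w-ok t)) sat∃)

    skolem^ : ∀ r {L} (φ : ℕ → Formula) → (∀ t → ConstFree (φ t)) → (∀ t → FVBelow (r + L) (φ t)) →
              Computable₁ B (λ t → ⌜ φ t ⌝) → ∀ E → ComputableEnv B E → ProductEnv E →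
              (∀ t → SatM (E at t) (∃^ r (φ t))) →
              Σ (ℕ → ℕ → ℕ) λ F → ComputableEnv B F × ProductEnv F × (∀ t → SatM (F at t) (φ t)) × (∀ i → F (r + i) ≡ E i)
    skolem^ zero φ cf fv cφ E cE E∈ sat = E , cE , E∈ , sat , λ i → refl
    skolem^ (suc r) {L} φ cf fv cφ E cE E∈ sat =
      let (w , cw , w∈ , witness) = skolem (λ t → ∃^ r (φ t)) (λ t → ∃^-ConstFree r (φ t) (cf t))
                                           (λ t → ∃^-FVBelow r (φ t) (FVBelow-+-suc r (φ t) (fv t)))
                                           (∃^-code-computable r) E cE E∈
          (F , cF , F∈ , satF , F≡w∷E) = skolem^ r φ cf (λ t → FVBelow-+-suc r (φ t) (fv t)) cφ (w ∷ᴷ E)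
                                                   (∷ᴷ-ComputableEnv cw cE) (∷ᴷ-ProductEnv w∈ E∈) (λ t → witness t (sat t))
      in F , cF , F∈ , satF , λ i → trans (cong F (sym (+-suc r i))) (F≡w∷E (suc i))
      where
      ∃^-code-computable : ∀ r → Computable₁ B (λ t → ⌜ ∃^ r (φ t) ⌝)
      ∃^-code-computable r = computable-ext (λ { (t ∷ []) → sym (⌜∃^⌝ r (φ t)) }) (∃^Code-computable r cφ)

  evalT-at : ∀ κ ρ t → AllConstsᵗ (λ _ → ⊥) t → ∀ n → evalT K κ ρ t n ≡ evalT (asPre M) (λ j → j) (ρ at n) t
  evalT-at κ ρ (var x) _ n = refl
  evalT-at κ ρ (con x) () n
  evalT-at κ ρ `0 _ n = refl
  evalT-at κ ρ `1 _ n = refl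
  evalT-at κ ρ (s `+ t) (cs , ct) n = cong₂ add (evalT-at κ ρ s cs n) (evalT-at κ ρ t ct n)
  evalT-at κ ρ (s `* t) (cs , ct) n = cong₂ mul (evalT-at κ ρ s cs n) (evalT-at κ ρ t ct n)

  ∷ᴷ-at : ∀ f ρ n i → ((f ∷ᴷ ρ) at n) i ≡ _∷ₑ_ (asPre M) (f n) (ρ at n) i
  ∷ᴷ-at f ρ n zero = refl
  ∷ᴷ-at f ρ n (suc i) = refl

  module _ (k : ℕ) (φ ψ : Formula) (ρ : ℕ → ℕ → ℕ) (cφ : ConstFree φ) (cψ : ConstFree ψ) (fφ : FVBelow k φ) (fψ : FVBelow k ψ) (ρ∈ : ProductEnv ρ) where

    truthSet-∧ : ∀ n → truthSet k (φ `∧ ψ) ρ n ≡ (truthSet k φ ρ n ∧ truthSet k ψ ρ n)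
    truthSet-∧ n = det (truthSet-reflects k (φ `∧ ψ) ρ (cφ , cψ) (fφ , fψ) ρ∈ n)
                       (truthSet-reflects k φ ρ cφ fφ ρ∈ n ×-reflects truthSet-reflects k ψ ρ cψ fψ ρ∈ n)

    truthSet-∨ : ∀ n → truthSet k (φ `∨ ψ) ρ n ≡ (truthSet k φ ρ n ∨ truthSet k ψ ρ n)
    truthSet-∨ n = det (truthSet-reflects k (φ `∨ ψ) ρ (cφ , cψ) (fφ , fψ) ρ∈ n)
                       (truthSet-reflects k φ ρ cφ fφ ρ∈ n ⊎-reflects truthSet-reflects k ψ ρ cψ fψ ρ∈ n)

    truthSet-→ : ∀ n → truthSet k (φ `→ ψ) ρ n ≡ (not (truthSet k φ ρ n) ∨ truthSet k ψ ρ n)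
    truthSet-→ n = det (truthSet-reflects k (φ `→ ψ) ρ (cφ , cψ) (fφ , fψ) ρ∈ n)
                       (truthSet-reflects k φ ρ cφ fφ ρ∈ n →-reflects truthSet-reflects k ψ ρ cψ fψ ρ∈ n)

  Łoś-for : ℕ → Formula → Set
  Łoś-for k φ = ∀ {B} → ComputesDiagram B → ∀ ρ → ComputableEnv B ρ → ProductEnv ρ → ∀ κ →
                Sat K κ ρ φ ⇔ U (truthSet k φ ρ)

  łoś-∃ : ∀ k φ → ConstFree φ → FVBelow (suc k) φ → Łoś-for (suc k) φ → Łoś-for k (`∃ φ)
  łoś-∃ k φ cf fv łoś-φ Bd ρ cρ ρ∈ κ = mk⇔ sat⇒large large⇒sat
    where
    ∃-reflects : ∀ n → Reflects (SatM (ρ at n) (`∃ φ)) (truthSet k (`∃ φ) ρ n)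
    ∃-reflects = truthSet-reflects k (`∃ φ) ρ cf fv ρ∈
    φ-reflects : ∀ f → InProd X M f → ∀ n → Reflects (SatM ((f ∷ᴷ ρ) at n) φ) (truthSet (suc k) φ (f ∷ᴷ ρ) n)
    φ-reflects f f∈ = truthSet-reflects (suc k) φ (f ∷ᴷ ρ) cf fv (∷ᴷ-ProductEnv f∈ ρ∈)
    sat⇒large : Sat K κ ρ (`∃ φ) → U (truthSet k (`∃ φ) ρ)
    sat⇒large (f , f∈ , sat) =
      upward (łoś-φ (⊕graph-ComputesDiagram Bd f∈) (f ∷ᴷ ρ) (⊕graph-ComputableEnv cρ) (∷ᴷ-ProductEnv f∈ ρ∈) κ .to sat)
             (X-truthSet Bd k (`∃ φ) ρ cρ)
             (λ n e → reflects-⇒true (∃-reflects n)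
                        (f n , proj₁ f∈ n , Sat-cong _ φ (∷ᴷ-at f ρ n) .to (reflects-true⇒ (φ-reflects f f∈ n) e)))
    large⇒sat : U (truthSet k (`∃ φ) ρ) → Sat K κ ρ (`∃ φ)
    large⇒sat u =
      let (w , cw , w∈ , witness) = skolem Bd (λ _ → φ) (λ _ → cf) (λ _ → fv) (const-computable ⌜ φ ⌝) ρ cρ ρ∈ in
      w , w∈ , łoś-φ Bd (w ∷ᴷ ρ) (∷ᴷ-ComputableEnv cw cρ) (∷ᴷ-ProductEnv w∈ ρ∈) κ .from
                 (upward u (X-truthSet Bd (suc k) φ (w ∷ᴷ ρ) (∷ᴷ-ComputableEnv cw cρ))
                   (λ n e → reflects-⇒true (φ-reflects w w∈ n) (witness n (reflects-true⇒ (∃-reflects n) e))))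

  łoś-∀ : ∀ k φ → ConstFree φ → FVBelow (suc k) φ → Łoś-for (suc k) φ → Łoś-for k (`∀ φ)
  łoś-∀ k φ cf fv łoś-φ Bd ρ cρ ρ∈ κ = mk⇔ sat⇒large large⇒sat
    where
    ∀-reflects : ∀ n → Reflects (SatM (ρ at n) (`∀ φ)) (truthSet k (`∀ φ) ρ n)
    ∀-reflects = truthSet-reflects k (`∀ φ) ρ cf fv ρ∈
    φ-reflects : ∀ f → InProd X M f → ∀ n → Reflects (SatM ((f ∷ᴷ ρ) at n) φ) (truthSet (suc k) φ (f ∷ᴷ ρ) n)
    φ-reflects f f∈ = truthSet-reflects (suc k) φ (f ∷ᴷ ρ) cf fv (∷ᴷ-ProductEnv f∈ ρ∈)
    ρ∈-at : ∀ n i → dom ((ρ at n) i) ≡ true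
    ρ∈-at n i = proj₁ (ρ∈ i) n
    -- A Skolem function for ¬φ picks a counterexample wherever there is one.
    sat⇒large : Sat K κ ρ (`∀ φ) → U (truthSet k (`∀ φ) ρ)
    sat⇒large sat =
      let (w , cw , w∈ , counterexample) = skolem Bd (λ _ → `¬ φ) (λ _ → cf , tt) (λ _ → fv , tt) (const-computable ⌜ `¬ φ ⌝) ρ cρ ρ∈ in
      upward (łoś-φ Bd (w ∷ᴷ ρ) (∷ᴷ-ComputableEnv cw cρ) (∷ᴷ-ProductEnv w∈ ρ∈) κ .to (sat w w∈))
             (X-truthSet Bd k (`∀ φ) ρ cρ)
             (λ n e → reflects-⇒true (∀-reflects n)
                        (¬∃¬⇒∀ φ (ρ at n) cf fv (ρ∈-at n)
                          (λ ∃¬ → counterexample n ∃¬ (reflects-true⇒ (φ-reflects w w∈ n) e))))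
    large⇒sat : U (truthSet k (`∀ φ) ρ) → Sat K κ ρ (`∀ φ)
    large⇒sat u f f∈ =
      łoś-φ (⊕graph-ComputesDiagram Bd f∈) (f ∷ᴷ ρ) (⊕graph-ComputableEnv cρ) (∷ᴷ-ProductEnv f∈ ρ∈) κ .from
        (upward u (X-truthSet (⊕graph-ComputesDiagram Bd f∈) (suc k) φ (f ∷ᴷ ρ) (⊕graph-ComputableEnv cρ))
          (λ n e → reflects-⇒true (φ-reflects f f∈ n)
                     (Sat-cong _ φ (∷ᴷ-at f ρ n) .from (reflects-true⇒ (∀-reflects n) e (f n) (proj₁ f∈ n)))))

  łoś : ∀ k φ → ConstFree φ → FVBelow k φ → Łoś-for k φ
  łoś k (s `= t) cf@(cs , ct) fv Bd ρ cρ ρ∈ κ = U-cong-⇔ pointwise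
    where
    pointwise : ∀ n → (evalT K κ ρ s n ≡ᵇ evalT K κ ρ t n) ≡ truthSet k (s `= t) ρ n
    pointwise n rewrite evalT-at κ ρ s cs n | evalT-at κ ρ t ct n =
      det (≡ᵇ-reflects _ _) (truthSet-reflects k (s `= t) ρ cf fv ρ∈ n)
  łoś k (s `< t) cf@(cs , ct) fv Bd ρ cρ ρ∈ κ = U-cong-⇔ pointwise
    where
    pointwise : ∀ n → lt (evalT K κ ρ s n) (evalT K κ ρ t n) ≡ truthSet k (s `< t) ρ n
    pointwise n rewrite evalT-at κ ρ s cs n | evalT-at κ ρ t ct n =
      det (≡true-reflects _) (truthSet-reflects k (s `< t) ρ cf fv ρ∈ n)
  łoś k `⊥ cf fv Bd ρ cρ ρ∈ κ =
    mk⇔ (λ ()) (λ u → U-nonempty u (λ n → det (truthSet-reflects k `⊥ ρ cf fv ρ∈ n) (ofⁿ λ ())))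
  łoś k (φ `∧ ψ) (cφ , cψ) (fφ , fψ) Bd ρ cρ ρ∈ κ =
    U-cong-⇔ (sym ∘ truthSet-∧ k φ ψ ρ cφ cψ fφ fψ ρ∈)
      ⇔-∘ (⇔-sym (U-∧ (X-truthSet Bd k φ ρ cρ) (X-truthSet Bd k ψ ρ cρ))
      ⇔-∘ (łoś k φ cφ fφ Bd ρ cρ ρ∈ κ ×-⇔ łoś k ψ cψ fψ Bd ρ cρ ρ∈ κ))
  łoś k (φ `∨ ψ) (cφ , cψ) (fφ , fψ) Bd ρ cρ ρ∈ κ =
    U-cong-⇔ (sym ∘ truthSet-∨ k φ ψ ρ cφ cψ fφ fψ ρ∈)
      ⇔-∘ (⇔-sym (U-∨ (X-truthSet Bd k φ ρ cρ) (X-truthSet Bd k ψ ρ cρ))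
      ⇔-∘ (łoś k φ cφ fφ Bd ρ cρ ρ∈ κ ⊎-⇔ łoś k ψ cψ fψ Bd ρ cρ ρ∈ κ))
  łoś k (φ `→ ψ) (cφ , cψ) (fφ , fψ) Bd ρ cρ ρ∈ κ =
    U-cong-⇔ (sym ∘ truthSet-→ k φ ψ ρ cφ cψ fφ fψ ρ∈)
      ⇔-∘ (⇔-sym (U-⇒ (X-truthSet Bd k φ ρ cρ) (X-truthSet Bd k ψ ρ cρ))
      ⇔-∘ →-cong-⇔ (łoś k φ cφ fφ Bd ρ cρ ρ∈ κ) (łoś k ψ cψ fψ Bd ρ cρ ρ∈ κ))
  łoś k (`∀ φ) cf fv = łoś-∀ k φ cf fv (łoś (suc k) φ cf fv)
  łoś k (`∃ φ) cf fv = łoś-∃ k φ cf fv (łoś (suc k) φ cf fv)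

-- Realizing a recursive type

lookupℕ-All : ∀ {A : Set} (Q : A → Set) {m} (a : Fin m → A) d → (∀ j → Q (a j)) → Q d → ∀ i → Q (lookupℕ a d i)
lookupℕ-All Q {zero} a d Qa Qd i = Qd
lookupℕ-All Q {suc m} a d Qa Qd zero = Qa fzero
lookupℕ-All Q {suc m} a d Qa Qd (suc i) = lookupℕ-All Q (a ∘ fsuc) d (Qa ∘ fsuc) Qd i

cat-+ : ∀ {A : Set} n {m} (b : Fin n → A) (a : Fin m → A) d i → cat b a d (n + i) ≡ lookupℕ a d i
cat-+ zero b a d i = refl
cat-+ (suc n) b a d i = cat-+ n (b ∘ fsuc) a d i

cat-toℕ : ∀ {A : Set} n {m} (F : ℕ → A) (a : Fin m → A) d → (∀ i → F (n + i) ≡ lookupℕ a d i) →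
          ∀ i → cat {n = n} (F ∘ toℕ) a d i ≡ F i
cat-toℕ zero F a d F-tail i = sym (F-tail i)
cat-toℕ (suc n) F a d F-tail zero = refl
cat-toℕ (suc n) F a d F-tail (suc i) = cat-toℕ n (F ∘ suc) a d F-tail i

module Realization {X : Subset → Set} (SS : ScottSet X) (M : ωStructure) (coded : CodedIn X M)
                   {U : Subset → Set} (UF : NonPrincipalUltrafilter X U)
                   (N m : ℕ) (a : Fin m → ℕ → ℕ) (a∈ : ∀ i → InProd X M (a i))
                   (P : Subset) (P-recursive : Recursive P)
                   (P-formulas : ∀ k → P k ≡ true → Σ Formula λ ψ → (⌜ ψ ⌝ ≡ k) × ConstFree ψ × FVBelow (N + m) ψ)
                   (consistent : Consistent (TypeTheory (UltraProduct X U M) N m a P)) where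
  open ωStructure M
  open NonPrincipalUltrafilter UF
  open ScottSetClosure SS
  open UltrafilterLaws SS UF
  open Łoś SS M coded UF
  open Semantics

  oracle₀ : Subset
  oracle₀ = D ⊕ dom ⊕ graphs m a

  oracle₀-ComputesDiagram : ComputesDiagram oracle₀
  oracle₀-ComputesDiagram = record
    { X-oracle = X-⊕ X-D (X-⊕ X-dom (X-graphs m a a∈))
    ; D-computable = ⊕-computableˡ D (dom ⊕ graphs m a)
    ; dom-computable = computable-trans (⊕-computableʳ D (dom ⊕ graphs m a)) (⊕-computableˡ dom (graphs m a))
    }
    where
    X-graphs : ∀ m a → (∀ i → InProd X M (a i)) → X (graphs m a)
    X-graphs zero a a∈ = X-computable X-D (const-computable 0)
    X-graphs (suc m) a a∈ = X-⊕ (proj₂ (a∈ fzero)) (X-graphs m (a ∘ fsuc) (a∈ ∘ fsuc))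

  params : ℕ → ℕ → ℕ
  params = lookupℕ a (λ _ → z)

  params-computable : ComputableEnv oracle₀ params
  params-computable = lookupℕ-All (Computable₁ oracle₀) a _ computes-a (const-computable z)
    where
    computes-a : ∀ i → Computable₁ oracle₀ (a i)
    computes-a i = computable-trans (⊕-computableʳ D (dom ⊕ graphs m a)) (computable-trans (⊕-computableʳ dom (graphs m a)) (graphs-computes m a i))

  params-product : ProductEnv params
  params-product = lookupℕ-All (InProd X M) a _ a∈ (computable-InProd oracle₀-ComputesDiagram (const-computable z) (λ _ → z∈))

  P-computable : ComputableSet oracle₀ P
  P-computable = computable-trans (const-computable 0) (≤T⇒computableSet P-recursive)

  member : ∀ j → P j ≡ true → Formula
  member j e = proj₁ (P-formulas j e)

  -- typeConj j is θ_j, the conjunction of the members of the type with code below j.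
  conjIf : ∀ j b → P j ≡ b → Formula → Formula
  conjIf j true e θ = member j e `∧ θ
  conjIf j false e θ = θ

  typeConj : ℕ → Formula
  typeConj zero = `0 `= `0
  typeConj (suc j) = conjIf j (P j) refl (typeConj j)

  -- member j has code j, so the codes of the θ_j are computable from P alone.
  typeConjCode : ℕ → ℕ
  typeConjCode zero = ⌜ `0 `= `0 ⌝
  typeConjCode (suc j) = if P j then pair 3 (pair j (typeConjCode j)) else typeConjCode j

  ⌜typeConj⌝ : ∀ j → ⌜ typeConj j ⌝ ≡ typeConjCode j
  ⌜typeConj⌝ zero = refl
  ⌜typeConj⌝ (suc j) = ⌜conjIf⌝ (P j) refl (typeConj j) (⌜typeConj⌝ j)
    where
    ⌜conjIf⌝ : ∀ b (e : P j ≡ b) θ {c} → ⌜ θ ⌝ ≡ c → ⌜ conjIf j b e θ ⌝ ≡ (if b then pair 3 (pair j c) else c)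
    ⌜conjIf⌝ true e θ refl = cong (λ c → pair 3 (pair c ⌜ θ ⌝)) (proj₁ (proj₂ (P-formulas j e)))
    ⌜conjIf⌝ false e θ ⌜θ⌝ = ⌜θ⌝

  typeConj-ConstFree : ∀ j → ConstFree (typeConj j)
  typeConj-ConstFree zero = tt , tt
  typeConj-ConstFree (suc j) = conjIf-ConstFree (P j) refl (typeConj j) (typeConj-ConstFree j)
    where
    conjIf-ConstFree : ∀ b (e : P j ≡ b) θ → ConstFree θ → ConstFree (conjIf j b e θ)
    conjIf-ConstFree true e θ cθ = proj₁ (proj₂ (proj₂ (P-formulas j e))) , cθ
    conjIf-ConstFree false e θ cθ = cθ

  typeConj-FVBelow : ∀ j → FVBelow (N + m) (typeConj j)
  typeConj-FVBelow zero = tt , tt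
  typeConj-FVBelow (suc j) = conjIf-FVBelow (P j) refl (typeConj j) (typeConj-FVBelow j)
    where
    conjIf-FVBelow : ∀ b (e : P j ≡ b) θ → FVBelow (N + m) θ → FVBelow (N + m) (conjIf j b e θ)
    conjIf-FVBelow true e θ fθ = proj₂ (proj₂ (proj₂ (P-formulas j e))) , fθ
    conjIf-FVBelow false e θ fθ = fθ

  typeConj-Sat : ∀ v k → SatM v (typeConj k) → ∀ ψ → P ⌜ ψ ⌝ ≡ true → ⌜ ψ ⌝ < k → SatM v ψ
  typeConj-Sat v (suc k) sat ψ Pψ ψ<1+k with m≤n⇒m<n∨m≡n (≤-pred ψ<1+k)
  ... | inj₁ ψ<k = typeConj-Sat v k (conjIf-tail (P k) refl (typeConj k) sat) ψ Pψ ψ<k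
    where
    conjIf-tail : ∀ b (e : P k ≡ b) θ → SatM v (conjIf k b e θ) → SatM v θ
    conjIf-tail true e θ (_ , satθ) = satθ
    conjIf-tail false e θ satθ = satθ
  ... | inj₂ refl = conjIf-head (P ⌜ ψ ⌝) refl (typeConj ⌜ ψ ⌝) sat
    where
    conjIf-head : ∀ b (e : P ⌜ ψ ⌝ ≡ b) θ → SatM v (conjIf ⌜ ψ ⌝ b e θ) → SatM v ψ
    conjIf-head true e θ (sat-member , _) =
      subst (SatM v) (⌜⌝-injective (member ⌜ ψ ⌝ e) ψ (proj₁ (proj₂ (P-formulas ⌜ ψ ⌝ e)))) sat-member
    conjIf-head false e θ _ with () ← trans (sym Pψ) e

  typeConjCode-computable : Computable₁ oracle₀ typeConjCode
  typeConjCode-computable = computable-ext (λ { (j ∷ []) → rec≡typeConjCode j })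
    (rec-computable (const-computable (typeConjCode 0))
      (if-computable (∈-computable P P-computable x₀)
        (∘-computable₂ pair pair-computable (const-computable 3) (∘-computable₂ pair pair-computable x₀ x₁)) x₁))
    where
    rec≡typeConjCode : ∀ j → rec (λ _ → typeConjCode 0) (λ xs → if P (head xs) then pair 3 (pair (head xs) (head (tail xs))) else head (tail xs)) (j ∷ []) ≡ typeConjCode j
    rec≡typeConjCode zero = refl
    rec≡typeConjCode (suc j) = cong (λ c → if P j then pair 3 (pair j c) else c) (rec≡typeConjCode j)

  -- satisfiable j t decides M ⊨ ∃x̄ θ_j(x̄, ā(t)).
  satisfiable : ℕ → ℕ → Bool
  satisfiable j t = D (instantiateCode m (∃^Code N (typeConjCode j)) (params at t))

  satisfiable≡truthSet : ∀ j t → satisfiable j t ≡ truthSet m (∃^ N (typeConj j)) params t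
  satisfiable≡truthSet j t = cong (λ c → D (instantiateCode m c (params at t)))
                                  (trans (cong (∃^Code N) (sym (⌜typeConj⌝ j))) (sym (⌜∃^⌝ N (typeConj j))))

  typeConj∃-ConstFree : ∀ j → ConstFree (∃^ N (typeConj j))
  typeConj∃-ConstFree j = ∃^-ConstFree N (typeConj j) (typeConj-ConstFree j)

  typeConj∃-FVBelow : ∀ j → FVBelow m (∃^ N (typeConj j))
  typeConj∃-FVBelow j = ∃^-FVBelow N (typeConj j) (typeConj-FVBelow j)

  satisfiable-reflects : ∀ j t → Reflects (SatM (params at t) (∃^ N (typeConj j))) (satisfiable j t)
  satisfiable-reflects j t rewrite satisfiable≡truthSet j t =
    truthSet-reflects m (∃^ N (typeConj j)) params (typeConj∃-ConstFree j) (typeConj∃-FVBelow j) params-product t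

  satisfiable-computable : ComputablePred oracle₀ 2 (λ xs → satisfiable (head xs) (head (tail xs)))
  satisfiable-computable = instantiated-computable oracle₀-ComputesDiagram m
    (∃^Code-computable N (∘-computable₁ typeConjCode typeConjCode-computable x₀))
    (λ i → ∘-computable₁ (params i) (params-computable i) x₁)

  satisfiable-zero : ∀ t → satisfiable 0 t ≡ true
  satisfiable-zero t = reflects-⇒true (satisfiable-reflects 0 t) (trivially N _)
    where
    trivially : ∀ r v → SatM v (∃^ r (`0 `= `0))
    trivially zero v = refl
    trivially (suc r) v = z , z∈ , trivially r _

  bestUpTo : ℕ → ℕ → ℕ
  bestUpTo zero t = 0
  bestUpTo (suc j) t = if satisfiable (suc j) t then suc j else bestUpTo j t

  best : ℕ → ℕ
  best t = bestUpTo t t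

  bestUpTo-satisfiable : ∀ j t → satisfiable (bestUpTo j t) t ≡ true
  bestUpTo-satisfiable zero t = satisfiable-zero t
  bestUpTo-satisfiable (suc j) t with satisfiable (suc j) t in e
  ... | true = e
  ... | false = bestUpTo-satisfiable j t

  bestUpTo-maximal : ∀ j j' t → j' ≤ j → satisfiable j' t ≡ true → j' ≤ bestUpTo j t
  bestUpTo-maximal zero .zero t z≤n _ = z≤n
  bestUpTo-maximal (suc j) j' t j'≤1+j sat with satisfiable (suc j) t in e
  ... | true = j'≤1+j
  ... | false with m≤n⇒m<n∨m≡n j'≤1+j
  ...   | inj₁ j'<1+j = bestUpTo-maximal j j' t (≤-pred j'<1+j) sat
  ...   | inj₂ refl with () ← trans (sym e) sat

  best-computable : Computable₁ oracle₀ best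
  best-computable = ∘-computable₂ (λ j t → bestUpTo j t) bestUpTo-computable x₀ x₀
    where
    bestUpTo-computable : Computable₂ oracle₀ bestUpTo
    bestUpTo-computable = computable-ext (λ { (j ∷ t ∷ []) → rec≡bestUpTo j t })
      (rec-computable zero-computable
        (if-computable (∘-computable₂ (λ j t → bit (satisfiable j t)) satisfiable-computable (∘-computable₁ suc suc-computable x₀) x₂)
                       (∘-computable₁ suc suc-computable x₀) x₁))
      where
      rec≡bestUpTo : ∀ j t → rec (λ _ → 0) (λ xs → if satisfiable (suc (head xs)) (head (tail (tail xs))) then suc (head xs) else head (tail xs)) (j ∷ t ∷ []) ≡ bestUpTo j t
      rec≡bestUpTo zero t = refl
      rec≡bestUpTo (suc j) t = cong (λ b → if satisfiable (suc j) t then suc j else b) (rec≡bestUpTo j t)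

  TT : Formula → Set
  TT = TypeTheory K N m a P

  κₚ : ℕ → ℕ → ℕ
  κₚ = paramEnv K {N} {m} a

  typeConj-derivable : ∀ j → Deriv TT [] (substF con (typeConj j))
  typeConj-derivable zero = =refl `0
  typeConj-derivable (suc j) = conjIf-derivable (P j) refl (typeConj j) (typeConj-derivable j)
    where
    conjIf-derivable : ∀ b (e : P j ≡ b) θ → Deriv TT [] (substF con θ) → Deriv TT [] (substF con (conjIf j b e θ))
    conjIf-derivable true e θ d =
      ∧I (ax (inj₂ (member j e , subst (λ k → P k ≡ true) (sym ⌜member⌝) e , refl))
             (substF-FVBelow con (member j e) (proj₂ (proj₂ (proj₂ (P-formulas j e)))) (λ _ _ → tt)))
         d
      where
      ⌜member⌝ : ⌜ member j e ⌝ ≡ j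
      ⌜member⌝ = proj₁ (proj₂ (P-formulas j e))
    conjIf-derivable false e θ d = d

  -- Otherwise K ⊨ ¬∃x̄ θ_j(x̄, ā) by Łoś, so the type would refute a sentence of Th(K, ā).
  satisfiable-large : ∀ j → U (satisfiable j)
  satisfiable-large j =
    either (λ u → u) (λ u → ⊥-elim (consistent (→E (ax (refutation-in-theory u) refutation-sentence) ∃-derivable)))
           (ultra (X-computableFrom oracle₀-ComputesDiagram (∘-computable₂ (λ j t → bit (satisfiable j t)) satisfiable-computable (const-computable j) x₀)))
    where
    φ : Formula
    φ = ∃^ N (typeConj j)
    τ : ℕ → Term
    τ i = con (N + i)
    refutation-sentence : Sentence (substF τ (`¬ φ))
    refutation-sentence = substF-FVBelow τ (`¬ φ) (typeConj∃-FVBelow j , tt) (λ _ _ → tt)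
    refutation-consts : AllConsts (λ c → (N ≤ c) × (c < N + m)) (substF τ (`¬ φ))
    refutation-consts = substF-AllConsts _ τ (`¬ φ) (ConstFree⇒AllConsts _ φ (typeConj∃-ConstFree j) , tt)
                          (typeConj∃-FVBelow j , tt) (λ i i<m → m≤m+n N i , +-monoʳ-< N i<m)
    K⊨¬φ : U (λ t → not (satisfiable j t)) → Sat K κₚ params (`¬ φ)
    K⊨¬φ u sat = U-nonempty (inter (U-cong (sym ∘ satisfiable≡truthSet j) (łoś-φ .to sat)) u) (∧-inverseʳ ∘ satisfiable j)
      where
      łoś-φ : Sat K κₚ params φ ⇔ U (truthSet m φ params)
      łoś-φ = łoś m φ (typeConj∃-ConstFree j) (typeConj∃-FVBelow j) oracle₀-ComputesDiagram params params-computable params-product κₚ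
    refutation-in-theory : U (λ t → not (satisfiable j t)) → TT (substF τ (`¬ φ))
    refutation-in-theory u =
      inj₁ (refutation-sentence , refutation-consts ,
            Sat-substF K κₚ _ τ (`¬ φ) .from (Sat-cong K κₚ (`¬ φ) (cat-+ N _ a _) .from (K⊨¬φ u)))
    ∃-derivable : Deriv TT [] (substF τ φ)
    ∃-derivable = ∃^-intro N (typeConj j) (typeConj-derivable j)

  realizers : Σ (ℕ → ℕ → ℕ) λ F → ComputableEnv oracle₀ F × ProductEnv F ×
                (∀ t → SatM (F at t) (typeConj (best t))) × (∀ i → F (N + i) ≡ params i)
  realizers = skolem^ oracle₀-ComputesDiagram N (typeConj ∘ best) (typeConj-ConstFree ∘ best) (typeConj-FVBelow ∘ best)
                (computable-ext (λ { (t ∷ []) → sym (⌜typeConj⌝ (best t)) }) (∘-computable₁ typeConjCode typeConjCode-computable best-computable))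
                params params-computable params-product
                (λ t → reflects-true⇒ (satisfiable-reflects (best t) t) (bestUpTo-satisfiable t t))

  F : ℕ → ℕ → ℕ
  F = proj₁ realizers

  F-computable : ComputableEnv oracle₀ F
  F-computable = proj₁ (proj₂ realizers)

  F-product : ProductEnv F
  F-product = proj₁ (proj₂ (proj₂ realizers))

  F-realizes : ∀ t → SatM (F at t) (typeConj (best t))
  F-realizes = proj₁ (proj₂ (proj₂ (proj₂ realizers)))

  F-params : ∀ i → F (N + i) ≡ params i
  F-params = proj₂ (proj₂ (proj₂ (proj₂ realizers)))

  member-ConstFree : ∀ ψ → P ⌜ ψ ⌝ ≡ true → ConstFree ψ
  member-ConstFree ψ Pψ = subst ConstFree (⌜⌝-injective (member ⌜ ψ ⌝ Pψ) ψ (proj₁ (proj₂ (P-formulas ⌜ ψ ⌝ Pψ))))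
                                (proj₁ (proj₂ (proj₂ (P-formulas ⌜ ψ ⌝ Pψ))))

  member-FVBelow : ∀ ψ → P ⌜ ψ ⌝ ≡ true → FVBelow (N + m) ψ
  member-FVBelow ψ Pψ = subst (FVBelow (N + m)) (⌜⌝-injective (member ⌜ ψ ⌝ Pψ) ψ (proj₁ (proj₂ (P-formulas ⌜ ψ ⌝ Pψ))))
                              (proj₂ (proj₂ (proj₂ (P-formulas ⌜ ψ ⌝ Pψ))))

  -- Almost every t has best t > ⌜ ψ ⌝, and then F realizes ψ at t.
  realize : ∀ ψ → P ⌜ ψ ⌝ ≡ true → Sat K κₚ (cat {n = N} (F ∘ toℕ) a (λ _ → z)) ψ
  realize ψ Pψ =
    Sat-cong K κₚ ψ (cat-toℕ N F a _ F-params) .from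
      (łoś (N + m) ψ (member-ConstFree ψ Pψ) (member-FVBelow ψ Pψ) oracle₀-ComputesDiagram F F-computable F-product κₚ .from
        (upward (inter (satisfiable-large (suc ⌜ ψ ⌝)) (U-atLeast (suc ⌜ ψ ⌝)))
                (X-truthSet oracle₀-ComputesDiagram (N + m) ψ F F-computable) realized))
    where
    realized : ∀ t → (satisfiable (suc ⌜ ψ ⌝) t ∧ atLeast (suc ⌜ ψ ⌝) t) ≡ true → truthSet (N + m) ψ F t ≡ true
    realized t e =
      let (sat , above) = reflects-true⇒ (≡true-reflects _ ×-reflects ≡true-reflects _) e in
      reflects-⇒true (truthSet-reflects (N + m) ψ F (member-ConstFree ψ Pψ) (member-FVBelow ψ Pψ) F-product t)
        (typeConj-Sat (F at t) (best t) (F-realizes t) ψ Pψ (bestUpTo-maximal t (suc ⌜ ψ ⌝) t (atLeast-≤ _ t above) sat))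

mainTheorem2 : (X : Subset → Set) → ScottSet X →
    (T : Subset) → X T → IsLATheory T → ExtendsPA T → CompleteLA T → Consistent (AxOf T) →
    (M : ωStructure) → Models M T → CodedIn X M →
    (U : Subset → Set) → NonPrincipalUltrafilter X U →
    RecursivelySaturated (UltraProduct X U M)
mainTheorem2 X SS _ _ _ _ _ _ M _ coded U UF N m a a∈ P P-recursive P-formulas consistent =
  F ∘ toℕ , F-product ∘ toℕ , realize
  where open Realization SS M coded UF N m a a∈ P P-recursive P-formulas consistent
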